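{- For integers $k_1\le k_2\le N-2$, $$W_1(N,k_1,k_2)=\theta^2P_{N-2}\,W_1(N-1,k_1,k_2)+\theta\,T_1(N-1,k_1,k_2)+\sum_{i=k_1+1}^{k_2+1}\theta^{N-i-1}T_1(i-1,k_1)B(i-1,N-i-1)(P_{N-i-1})!$$ $$+\sum_{i=k_2+2}^{N-1}\theta^{N-i-1}T_1(i-1,k_1,k_2)B(i-1,N-i-1)(P_{N-i-1})!.$$
   Context: Let $\theta>0$ and $k_1\ge0$. $\mathrm{inv}(\pi)$ is the number of pairs $i<j$ with $\pi_i>\pi_j$. $P_n=1+\theta+\cdots+\theta^{n-1}$, $(P_n)!=P_n\cdots P_1$, $(P_0)!=1$. $B(n,m)=\sum\theta^{\#\{(a,b):a\in\Pi_1,b\in\Pi_2,a>b\}}$ over ordered partitions $(\Pi_1,\Pi_2)$ of $\{1,\dots,n+m\}$ with $|\Pi_1|=n,|\Pi_2|=m$. For $\pi\in S_n$, position $i$ is a left-to-right maximum if $\pi_i>\pi_j$ for all $j<i$, and a left-to-right second maximum if exactly one $j<i$ has $\pi_j>\pi_i$. $\pi$ is $k$-pickable if some position $i>k$ is a left-to-right maximum; $T_1(n,k)=\sum_{\pi\in S_n\text{ not }k\text{ -pickable}}\theta^{\mathrm{inv}(\pi)}$. The $(k_1,k_2)$-strategy accepts the first position $i$ such that either $i>k_1$ and $i$ is a left-to-right maximum, or $i>k_2$ and $i$ is a left-to-right second maximum (if there is none, the last position is accepted). $\pi\in S_n$ is $(k_1,k_2)$-pickable if this rule selects some position, and $(k_1,k_2)$-winnable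 if the accepted position holds value $n-1$. $T_1(n,k_1,k_2)=\sum_{\text{not }(k_1,k_2)\text{ -pickable}}\theta^{\mathrm{inv}(\pi)}$, $W_1(n,k_1,k_2)=\sum_{(k_1,k_2)\text{ -winnable}}\theta^{\mathrm{inv}(\pi)}$. -}

module Defs where

open import Data.Nat using (ℕ; zero; suc; _∸_; _<ᵇ_; _≡ᵇ_) renaming (_+_ to _+ℕ_)
open import Data.Bool using (Bool; true; false; if_then_else_; _∨_; _∧_; not)
open import Data.List using (List; []; _∷_; concatMap; map)
open import Data.Maybe using (Maybe; just; nothing; is-just)
open import Algebra.Bundles using (CommutativeSemiring)
open import Level using (Level)

insertions : ℕ → List ℕ → List (List ℕ)
insertions x [] = (x ∷ []) ∷ []
insertions x (y ∷ ys) = (x ∷ y ∷ ys) ∷ map (y ∷_) (insertions x ys)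

-- S_n : all permutations of {1,…,n} in one-line notation, each exactly once
perms : ℕ → List (List ℕ)
perms zero = [] ∷ []
perms (suc n) = concatMap (insertions (suc n)) (perms n)

greaterCount : ℕ → List ℕ → ℕ
greaterCount x [] = 0
greaterCount x (y ∷ ys) = (if x <ᵇ y then 1 else 0) +ℕ greaterCount x ys

lessCount : ℕ → List ℕ → ℕ
lessCount x [] = 0
lessCount x (y ∷ ys) = (if y <ᵇ x then 1 else 0) +ℕ lessCount x ys

inv : List ℕ → ℕ
inv [] = 0
inv (x ∷ xs) = lessCount x xs +ℕ inv xs

-- position i (holding x, with the earlier entries `prefix`) is a
-- left-to-right maximum / left-to-right second maximum
isLRMax : List ℕ → ℕ → Bool
isLRMax prefix x = (greaterCount x prefix) ≡ᵇ 0

isLRSecond : List ℕ → ℕ → Bool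
isLRSecond prefix x = (greaterCount x prefix) ≡ᵇ 1

-- k-pickable: some position i > k is a left-to-right maximum.
-- `pick1 k prefix i xs` : i is the (1-based) position of the head of xs.
pick1 : ℕ → List ℕ → ℕ → List ℕ → Bool
pick1 k prefix i [] = false
pick1 k prefix i (x ∷ xs) = ((k <ᵇ i) ∧ isLRMax prefix x) ∨ pick1 k (x ∷ prefix) (suc i) xs

pickable1 : ℕ → List ℕ → Bool
pickable1 k π = pick1 k [] 1 π

select2 : ℕ → ℕ → List ℕ → ℕ → List ℕ → Maybe ℕ
select2 k₁ k₂ prefix i [] = nothing
select2 k₁ k₂ prefix i (x ∷ xs) =
  if ((k₁ <ᵇ i) ∧ isLRMax prefix x) ∨ ((k₂ <ᵇ i) ∧ isLRSecond prefix x)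
  then just x
  else select2 k₁ k₂ (x ∷ prefix) (suc i) xs

pickable2 : ℕ → ℕ → List ℕ → Bool
pickable2 k₁ k₂ π = is-just (select2 k₁ k₂ [] 1 π)

lastMaybe : List ℕ → Maybe ℕ
lastMaybe [] = nothing
lastMaybe (x ∷ []) = just x
lastMaybe (x ∷ y ∷ ys) = lastMaybe (y ∷ ys)

accepted : ℕ → ℕ → List ℕ → Maybe ℕ
accepted k₁ k₂ π with select2 k₁ k₂ [] 1 π
... | just v = just v
... | nothing = lastMaybe π

winnable2 : ℕ → ℕ → ℕ → List ℕ → Bool
winnable2 n k₁ k₂ π with accepted k₁ k₂ π
... | just v = v ≡ᵇ (n ∸ 1)
... | nothing = false

-- ordered partitions (Π₁,Π₂) of {1..L}: encoded by a Bool list of length L,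
-- entry j is true iff j ∈ Π₁.
boolLists : ℕ → List (List Bool)
boolLists zero = [] ∷ []
boolLists (suc L) = concatMap (λ bs → (true ∷ bs) ∷ (false ∷ bs) ∷ []) (boolLists L)

trues : List Bool → ℕ
trues [] = 0
trues (true ∷ bs) = suc (trues bs)
trues (false ∷ bs) = trues bs

-- #{(a,b) : a ∈ Π₁, b ∈ Π₂, a > b}
crossB : List Bool → ℕ
crossB [] = 0
crossB (true ∷ bs) = crossB bs
crossB (false ∷ bs) = trues bs +ℕ crossB bs

module GF {c ℓ : Level} (R : CommutativeSemiring c ℓ) (θ : CommutativeSemiring.Carrier R) where
  open CommutativeSemiring R

  pow : ℕ → Carrier
  pow zero = 1#
  pow (suc n) = θ * pow n

  sumIf : {A : Set} → (A → Bool) → (A → Carrier) → List A → Carrier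
  sumIf p f [] = 0#
  sumIf p f (a ∷ as) = (if p a then f a else 0#) + sumIf p f as

  -- Σ_{i=a}^{b} f i  (empty if b < a)
  sumFromTo : ℕ → ℕ → (ℕ → Carrier) → Carrier
  sumFromTo a b f = go a (suc b ∸ a)
    where
    go : ℕ → ℕ → Carrier
    go i zero = 0#
    go i (suc m) = f i + go (suc i) m

  P : ℕ → Carrier
  P zero = 0#
  P (suc n) = P n + pow n

  Pfact : ℕ → Carrier
  Pfact zero = 1#
  Pfact (suc n) = P (suc n) * Pfact n

  B : ℕ → ℕ → Carrier
  B n m = sumIf (λ bs → trues bs ≡ᵇ n) (λ bs → pow (crossB bs)) (boolLists (n +ℕ m))

  T₁ : ℕ → ℕ → Carrier
  T₁ n k = sumIf (λ π → not (pickable1 k π)) (λ π → pow (inv π)) (perms n)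

  T₁' : ℕ → ℕ → ℕ → Carrier
  T₁' n k₁ k₂ = sumIf (λ π → not (pickable2 k₁ k₂ π)) (λ π → pow (inv π)) (perms n)

  W₁ : ℕ → ℕ → ℕ → Carrier
  W₁ n k₁ k₂ = sumIf (winnable2 n k₁ k₂) (λ π → pow (inv π)) (perms n)

{-# OPTIONS --safe #-}
-- Write π ∈ S_N as a standardised σ ∈ S_{N-1} followed by its last value v; this last entry
-- contributes N − v inversions. If v < N − 1, π is won exactly when σ is (an accepted value of σ
-- is merely relabelled, and if σ accepts nothing its last entry is not N − 2, as that would be a
-- left-to-right second maximum past k₂); summing θ^{N−v} over these v gives θ²P_{N−2}·W₁(N−1).
-- If v = N − 1, π is won exactly when σ is not pickable: θ·T₁'(N−1). If v = N, π is won exactly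
-- when the strategy takes the maximum N − 1 of σ. With the maximum at position i, that happens iff
-- i > k₁ and the prefix before it is not pickable; the weight of these σ factors as
-- θ^{N−i−1}·T₁'(i−1)·B(i−1, N−i−1)·(P_{N−i−1})!, because a prefix statistic only sees the relative
-- order of the prefix, which is independent of how its values interleave with the rest. Finally,
-- for i ≤ k₂ + 1 the prefix is (k₁,k₂)-pickable iff it is k₁-pickable.
module Submission where

open import Defs
open import Level using (Level)
open import Algebra.Bundles using (CommutativeSemiring)
open import Data.Bool using (Bool; true; false; if_then_else_; _∧_; _∨_; not; T)
open import Data.Bool.Properties using (∧-zeroʳ; ∧-identityʳ; T-≡)
open import Data.List using (List; []; _∷_; _++_; map; concatMap; length; take; drop; _ʳ++_; initLast; _∷ʳ_; _∷ʳ′_)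
open import Data.List.Properties using (length-++; length-map; take-map; take-all)
open import Data.List.Relation.Unary.All as All using (All; []; _∷_)
import Data.List.Relation.Unary.All.Properties as All
open import Data.Maybe using (Maybe; just; nothing; is-just; _<∣>_) renaming (map to mapMaybe)
open import Data.Nat using (ℕ; zero; suc; _∸_; _≤_; _<_; s≤s; _<ᵇ_; _≡ᵇ_) renaming (_+_ to _+ℕ_)
import Data.Nat.Properties as ℕ
open import Data.Fin using (toℕ; inject₁; fromℕ)
open import Data.Fin.Properties using (toℕ<n; toℕ-inject₁; toℕ-fromℕ)
open import Data.Product using (_×_; _,_)
open import Function using (Equivalence)
open import Relation.Binary.PropositionalEquality as ≡ using (_≡_; _≢_)
open import Relation.Nullary using (yes; no; contradiction)

module Combinatorics where
  open import Data.Nat.Properties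
  open ≡
  import Algebra.Properties.CommutativeSemigroup +-commutativeSemigroup as ℕ+

  <ᵇ-true : ∀ {m n} → m < n → (m <ᵇ n) ≡ true
  <ᵇ-true m<n = Equivalence.to T-≡ (<⇒<ᵇ m<n)

  <ᵇ-false : ∀ {m n} → n ≤ m → (m <ᵇ n) ≡ false
  <ᵇ-false {m} {n} n≤m with m <ᵇ n in eq
  ... | false = refl
  ... | true  = contradiction (<ᵇ⇒< m n (subst T (sym eq) _)) (≤⇒≯ n≤m)

  ≡ᵇ-true : ∀ {m n} → m ≡ n → (m ≡ᵇ n) ≡ true
  ≡ᵇ-true {m} {n} m≡n = Equivalence.to T-≡ (≡⇒≡ᵇ m n m≡n)

  ≡ᵇ-false : ∀ {m n} → m ≢ n → (m ≡ᵇ n) ≡ false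
  ≡ᵇ-false {m} {n} m≢n with m ≡ᵇ n in eq
  ... | false = refl
  ... | true  = contradiction (≡ᵇ⇒≡ m n (subst T (sym eq) _)) m≢n

  greaterCount-++ : ∀ y xs ys → greaterCount y (xs ++ ys) ≡ greaterCount y xs +ℕ greaterCount y ys
  greaterCount-++ y []       ys = refl
  greaterCount-++ y (x ∷ xs) ys =
    trans (cong (_ +ℕ_) (greaterCount-++ y xs ys)) (sym (+-assoc (if y <ᵇ x then 1 else 0) (greaterCount y xs) (greaterCount y ys)))

  greaterCount-ʳ++ : ∀ y xs acc → greaterCount y (xs ʳ++ acc) ≡ greaterCount y xs +ℕ greaterCount y acc
  greaterCount-ʳ++ y []       acc = refl
  greaterCount-ʳ++ y (x ∷ xs) acc =
    trans (greaterCount-ʳ++ y xs (x ∷ acc)) (ℕ+.x∙yz≈yx∙z (greaterCount y xs) (if y <ᵇ x then 1 else 0) (greaterCount y acc))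

  lessCount-all< : ∀ a xs → All (_< a) xs → lessCount a xs ≡ length xs
  lessCount-all< a []       []         = refl
  lessCount-all< a (x ∷ xs) (x<a ∷ ps) rewrite <ᵇ-true x<a = cong suc (lessCount-all< a xs ps)

  greaterCount-all≤ : ∀ a xs → All (_≤ a) xs → greaterCount a xs ≡ 0
  greaterCount-all≤ a []       []         = refl
  greaterCount-all≤ a (x ∷ xs) (x≤a ∷ ps) rewrite <ᵇ-false x≤a = greaterCount-all≤ a xs ps

  greaterCount-ʳ++[]-all≤ : ∀ a xs → All (_≤ a) xs → greaterCount a (xs ʳ++ []) ≡ 0
  greaterCount-ʳ++[]-all≤ a xs bounded =
    trans (greaterCount-ʳ++ a xs []) (cong (_+ℕ 0) (greaterCount-all≤ a xs bounded))

  insertAt : ℕ → ℕ → List ℕ → List ℕ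
  insertAt j a xs = take j xs ++ a ∷ drop j xs

  length-insertAt : ∀ j a xs → length (insertAt j a xs) ≡ suc (length xs)
  length-insertAt zero    a xs       = refl
  length-insertAt (suc j) a []       = refl
  length-insertAt (suc j) a (x ∷ xs) = cong suc (length-insertAt j a xs)

  greaterCount-insertAt : ∀ y j a xs →
    greaterCount y (insertAt j a xs) ≡ (if y <ᵇ a then 1 else 0) +ℕ greaterCount y xs
  greaterCount-insertAt y zero    a xs       = refl
  greaterCount-insertAt y (suc j) a []       = refl
  greaterCount-insertAt y (suc j) a (x ∷ xs) =
    trans (cong ((if y <ᵇ x then 1 else 0) +ℕ_) (greaterCount-insertAt y j a xs))
          (ℕ+.x∙yz≈y∙xz (if y <ᵇ x then 1 else 0) (if y <ᵇ a then 1 else 0) (greaterCount y xs))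

  lessCount-insertAt : ∀ y j a xs →
    lessCount y (insertAt j a xs) ≡ (if a <ᵇ y then 1 else 0) +ℕ lessCount y xs
  lessCount-insertAt y zero    a xs       = refl
  lessCount-insertAt y (suc j) a []       = refl
  lessCount-insertAt y (suc j) a (x ∷ xs) =
    trans (cong ((if x <ᵇ y then 1 else 0) +ℕ_) (lessCount-insertAt y j a xs))
          (ℕ+.x∙yz≈y∙xz (if x <ᵇ y then 1 else 0) (if a <ᵇ y then 1 else 0) (lessCount y xs))

  inv-insertAt : ∀ j a xs → All (_< a) xs → inv (insertAt j a xs) ≡ (length xs ∸ j) +ℕ inv xs
  inv-insertAt zero    a xs       ps rewrite lessCount-all< a xs ps = refl
  inv-insertAt (suc j) a []       [] = refl
  inv-insertAt (suc j) a (x ∷ xs) (x<a ∷ ps)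
    rewrite lessCount-insertAt x j a xs | <ᵇ-false (<⇒≤ x<a) | inv-insertAt j a xs ps =
    ℕ+.x∙yz≈y∙xz (lessCount x xs) (length xs ∸ j) (inv xs)

  insertAt-++ : ∀ j a xs ys → j ≤ length xs → insertAt j a (xs ++ ys) ≡ insertAt j a xs ++ ys
  insertAt-++ zero    a xs       ys _         = refl
  insertAt-++ (suc j) a (x ∷ xs) ys (s≤s j≤) = cong (x ∷_) (insertAt-++ j a xs ys j≤)

  map-insertAt : ∀ (f : ℕ → ℕ) j a xs → map f (insertAt j a xs) ≡ insertAt j (f a) (map f xs)
  map-insertAt f zero    a xs       = refl
  map-insertAt f (suc j) a []       = refl
  map-insertAt f (suc j) a (x ∷ xs) = cong (f x ∷_) (map-insertAt f j a xs)

  insertAt-length : ∀ a xs → insertAt (length xs) a xs ≡ xs ++ a ∷ []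
  insertAt-length a []       = refl
  insertAt-length a (x ∷ xs) = cong (x ∷_) (insertAt-length a xs)

  All-insertAt : ∀ {P : ℕ → Set} j a xs → P a → All P xs → All P (insertAt j a xs)
  All-insertAt j a xs pa ps = All.++⁺ (All.take⁺ j ps) (pa ∷ All.drop⁺ j ps)

  All-insertions : ∀ {P : List ℕ → Set} a xs → (∀ j → P (insertAt j a xs)) → All P (insertions a xs)
  All-insertions     a []       h = h 0 ∷ []
  All-insertions {P} a (x ∷ xs) h =
    h 0 ∷ All.map⁺ (All-insertions {λ zs → P (x ∷ zs)} a xs (λ j → h (suc j)))

  take-++ˡ : ∀ m (xs ys : List ℕ) → m ≤ length xs → take m (xs ++ ys) ≡ take m xs
  take-++ˡ zero    xs       ys _         = refl
  take-++ˡ (suc m) (x ∷ xs) ys (s≤s m≤) = cong (x ∷_) (take-++ˡ m xs ys m≤)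

  length-take≤ : ∀ j (xs : List ℕ) → j ≤ length xs → length (take j xs) ≡ j
  length-take≤ zero    xs       _         = refl
  length-take≤ (suc j) (x ∷ xs) (s≤s j≤) = cong suc (length-take≤ j xs j≤)

  -- The three fields together say that σ lists 1, …, n once each.
  IsPerm : ℕ → List ℕ → Set
  IsPerm n σ = length σ ≡ n × All (_≤ n) σ × (∀ y → greaterCount y σ ≡ n ∸ y)

  IsPerm-insertAt : ∀ n σ j → IsPerm n σ → IsPerm (suc n) (insertAt j (suc n) σ)
  IsPerm-insertAt n σ j (len , bounded , counts) =
    trans (length-insertAt j (suc n) σ) (cong suc len) ,
    All-insertAt j (suc n) σ ≤-refl (All.map m≤n⇒m≤1+n bounded) ,
    λ y → trans (greaterCount-insertAt y j (suc n) σ)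
                (trans (cong ((if y <ᵇ suc n then 1 else 0) +ℕ_) (counts y)) (step y))
    where
    step : ∀ y → (if y <ᵇ suc n then 1 else 0) +ℕ (n ∸ y) ≡ suc n ∸ y
    step y with y ≤? n
    ... | yes y≤n rewrite <ᵇ-true (s≤s y≤n) = sym (+-∸-assoc 1 y≤n)
    ... | no  y≰n rewrite <ᵇ-false (≰⇒> y≰n) =
      trans (m≤n⇒m∸n≡0 (<⇒≤ (≰⇒> y≰n))) (sym (m≤n⇒m∸n≡0 (≰⇒> y≰n)))

  perms-IsPerm : ∀ n → All (IsPerm n) (perms n)
  perms-IsPerm zero    = (refl , [] , λ y → sym (0∸n≡0 y)) ∷ []
  perms-IsPerm (suc n) =
    All.concat⁺ (All.map⁺ (All.map (λ {σ} σ-perm →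
      All-insertions (suc n) σ (λ j → IsPerm-insertAt n σ j σ-perm)) (perms-IsPerm n)))

  bump : ℕ → ℕ → ℕ
  bump x v = if v <ᵇ x then v else suc v

  bump-< : ∀ {x v} → v < x → bump x v ≡ v
  bump-< v<x rewrite <ᵇ-true v<x = refl

  bump-≥ : ∀ {x v} → x ≤ v → bump x v ≡ suc v
  bump-≥ x≤v rewrite <ᵇ-false x≤v = refl

  bump-<ᵇ : ∀ x a b → (bump x a <ᵇ bump x b) ≡ (a <ᵇ b)
  bump-<ᵇ x a b with a <? x | b <? x
  ... | yes a<x | yes b<x rewrite bump-< a<x | bump-< b<x = refl
  ... | no  a≮x | no  b≮x rewrite bump-≥ (≮⇒≥ a≮x) | bump-≥ (≮⇒≥ b≮x) = refl
  ... | yes a<x | no  b≮x rewrite bump-< a<x | bump-≥ (≮⇒≥ b≮x) =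
    trans (<ᵇ-true (m<n⇒m<1+n a<b)) (sym (<ᵇ-true a<b))
    where a<b = <-≤-trans a<x (≮⇒≥ b≮x)
  ... | no  a≮x | yes b<x rewrite bump-≥ (≮⇒≥ a≮x) | bump-< b<x =
    trans (<ᵇ-false (m≤n⇒m≤1+n b≤a)) (sym (<ᵇ-false b≤a))
    where b≤a = ≤-trans (<⇒≤ b<x) (≮⇒≥ a≮x)

  greaterCount-bump : ∀ x a xs → greaterCount (bump x a) (map (bump x) xs) ≡ greaterCount a xs
  greaterCount-bump x a []       = refl
  greaterCount-bump x a (y ∷ ys) rewrite bump-<ᵇ x a y | greaterCount-bump x a ys = refl

  map-bump-all< : ∀ x σ → All (_< x) σ → map (bump x) σ ≡ σ
  map-bump-all< x []       []         = refl
  map-bump-all< x (y ∷ ys) (y<x ∷ ps) = cong₂ _∷_ (bump-< y<x) (map-bump-all< x ys ps)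

  appendLast : ℕ → List ℕ → List ℕ
  appendLast x σ = map (bump x) σ ++ x ∷ []

  length-appendLast : ∀ x σ → length (appendLast x σ) ≡ suc (length σ)
  length-appendLast x σ =
    trans (length-++ (map (bump x) σ)) (trans (+-comm _ 1) (cong suc (length-map (bump x) σ)))

  appendLast-insertAt : ∀ n x j ρ → length ρ ≡ n → x ≤ n → j ≤ n →
    insertAt j (suc (suc n)) (appendLast (suc x) ρ) ≡ appendLast (suc x) (insertAt j (suc n) ρ)
  appendLast-insertAt n x j ρ len x≤n j≤n = begin
    insertAt j (suc (suc n)) (map (bump (suc x)) ρ ++ suc x ∷ [])
      ≡⟨ insertAt-++ j _ (map (bump (suc x)) ρ) _ (subst (j ≤_) (sym (trans (length-map _ ρ) len)) j≤n) ⟩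
    insertAt j (suc (suc n)) (map (bump (suc x)) ρ) ++ suc x ∷ []
      ≡⟨ cong (λ a → insertAt j a (map (bump (suc x)) ρ) ++ suc x ∷ []) (sym (bump-≥ (s≤s x≤n))) ⟩
    insertAt j (bump (suc x) (suc n)) (map (bump (suc x)) ρ) ++ suc x ∷ []
      ≡⟨ cong (_++ suc x ∷ []) (sym (map-insertAt (bump (suc x)) j (suc n) ρ)) ⟩
    appendLast (suc x) (insertAt j (suc n) ρ) ∎
    where open ≡-Reasoning

  appendLast-max : ∀ n σ → All (_≤ n) σ → appendLast (suc n) σ ≡ σ ++ suc n ∷ []
  appendLast-max n σ bounded = cong (_++ suc n ∷ []) (map-bump-all< (suc n) σ (All.map s≤s bounded))

  lastMaybe-++ : ∀ ys x → lastMaybe (ys ++ x ∷ []) ≡ just x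
  lastMaybe-++ []           x = refl
  lastMaybe-++ (y ∷ [])     x = refl
  lastMaybe-++ (y ∷ z ∷ zs) x = lastMaybe-++ (z ∷ zs) x

  holds : ℕ → Maybe ℕ → Bool
  holds v (just w) = w ≡ᵇ v
  holds v nothing  = false

  module Strategy (k₁ k₂ : ℕ) where

    accepts : List ℕ → ℕ → ℕ → Bool
    accepts prefix i x = ((k₁ <ᵇ i) ∧ isLRMax prefix x) ∨ ((k₂ <ᵇ i) ∧ isLRSecond prefix x)

    select : List ℕ → ℕ → List ℕ → Maybe ℕ
    select = select2 k₁ k₂

    select-++ : ∀ prefix i xs ys →
      select prefix i (xs ++ ys) ≡ (select prefix i xs <∣> select (xs ʳ++ prefix) (length xs +ℕ i) ys)
    select-++ prefix i []       ys = refl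
    select-++ prefix i (x ∷ xs) ys with accepts prefix i x
    ... | true  = refl
    ... | false = trans (select-++ (x ∷ prefix) (suc i) xs ys)
                        (cong (λ j → select prefix′ (suc i) xs <∣> select (xs ʳ++ prefix′) j ys) (+-suc (length xs) i))
      where prefix′ = x ∷ prefix

    select-bump : ∀ x prefix i xs →
      select (map (bump x) prefix) i (map (bump x) xs) ≡ mapMaybe (bump x) (select prefix i xs)
    select-bump x prefix i []       = refl
    select-bump x prefix i (y ∷ ys) rewrite greaterCount-bump x y prefix with accepts prefix i y
    ... | true  = refl
    ... | false = select-bump x (y ∷ prefix) (suc i) ys

    pickable2-bump : ∀ x xs → pickable2 k₁ k₂ (map (bump x) xs) ≡ pickable2 k₁ k₂ xs
    pickable2-bump x xs with select [] 1 xs | select-bump x [] 1 xs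
    ... | just _  | eq = cong is-just eq
    ... | nothing | eq = cong is-just eq

    select-All : ∀ {P : ℕ → Set} prefix i xs {v} → All P xs → select prefix i xs ≡ just v → P v
    select-All prefix i (x ∷ xs) (px ∷ pxs) eq with accepts prefix i x
    select-All prefix i (x ∷ xs) (px ∷ pxs) refl | true = px
    ... | false = select-All (x ∷ prefix) (suc i) xs pxs eq

    select-LRMax : ∀ prefix i x xs → greaterCount x prefix ≡ 0 →
      select prefix i (x ∷ xs) ≡ (if k₁ <ᵇ i then just x else select (x ∷ prefix) (suc i) xs)
    select-LRMax prefix i x xs isMax rewrite isMax with k₁ <ᵇ i | k₂ <ᵇ i
    ... | true  | _     = refl
    ... | false | true  = refl
    ... | false | false = refl

    select-LRSecond : ∀ prefix i x → greaterCount x prefix ≡ 1 → k₂ < i → select prefix i (x ∷ []) ≡ just x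
    select-LRSecond prefix i x isSecond k₂<i rewrite isSecond | <ᵇ-true k₂<i with k₁ <ᵇ i
    ... | true  = refl
    ... | false = refl

    accepted-<∣> : ∀ π → accepted k₁ k₂ π ≡ (select [] 1 π <∣> lastMaybe π)
    accepted-<∣> π with select [] 1 π
    ... | just _  = refl
    ... | nothing = refl

    winnable2-holds : ∀ n π → winnable2 n k₁ k₂ π ≡ holds (n ∸ 1) (select [] 1 π <∣> lastMaybe π)
    winnable2-holds n π with accepted k₁ k₂ π | accepted-<∣> π
    ... | just _  | eq = cong (holds (n ∸ 1)) eq
    ... | nothing | eq = cong (holds (n ∸ 1)) eq

    accepted-appendLast : ∀ x σ →
      (select [] 1 (appendLast x σ) <∣> lastMaybe (appendLast x σ)) ≡ (mapMaybe (bump x) (select [] 1 σ) <∣> just x)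
    accepted-appendLast x σ
      rewrite select-++ [] 1 (map (bump x) σ) (x ∷ []) | select-bump x [] 1 σ | lastMaybe-++ (map (bump x) σ) x
      with select [] 1 σ
    ... | just _  = refl
    ... | nothing with accepts (map (bump x) σ ʳ++ []) (length (map (bump x) σ) +ℕ 1) x
    ...   | true  = refl
    ...   | false = refl

    winnable2-appendLast : ∀ n x σ →
      winnable2 n k₁ k₂ (appendLast x σ) ≡ holds (n ∸ 1) (mapMaybe (bump x) (select [] 1 σ) <∣> just x)
    winnable2-appendLast n x σ = trans (winnable2-holds n (appendLast x σ)) (cong (holds (n ∸ 1)) (accepted-appendLast x σ))

    -- A final entry n of σ ∈ S_{n+1} would be a left-to-right second maximum at position n + 1 > k₂.
    unselected-last : ∀ n σ → IsPerm (suc n) σ → k₂ ≤ n → select [] 1 σ ≡ nothing → holds n (lastMaybe σ) ≡ false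
    unselected-last n σ σ-perm k₂≤n none with initLast σ
    unselected-last n .[] _ k₂≤n none | [] = refl
    unselected-last n .(xs ∷ʳ z) (len , _ , counts) k₂≤n none | xs ∷ʳ′ z rewrite lastMaybe-++ xs z with z ≟ n
    ... | no  z≢n  = ≡ᵇ-false z≢n
    ... | yes refl = contradiction (trans (sym (select-LRSecond (xs ʳ++ []) (length xs +ℕ 1) n second k₂<i)) lastUnselected) λ ()
      where
      lastUnselected : select (xs ʳ++ []) (length xs +ℕ 1) (n ∷ []) ≡ nothing
      lastUnselected with select [] 1 xs | select-++ [] 1 xs (n ∷ [])
      ... | nothing | eq = trans (sym eq) none
      ... | just _  | eq = contradiction (trans (sym eq) none) λ ()
      k₂<i : k₂ < length xs +ℕ 1
      k₂<i = subst (k₂ <_) (sym (trans (sym (length-++ xs)) len)) (s≤s k₂≤n)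
      second : greaterCount n (xs ʳ++ []) ≡ 1
      second = begin
        greaterCount n (xs ʳ++ [])                    ≡⟨ greaterCount-ʳ++ n xs [] ⟩
        greaterCount n xs +ℕ 0                        ≡⟨ cong (greaterCount n xs +ℕ_) (greaterCount-all≤ n (n ∷ []) (≤-refl ∷ [])) ⟨
        greaterCount n xs +ℕ greaterCount n (n ∷ [])  ≡⟨ greaterCount-++ n xs (n ∷ []) ⟨
        greaterCount n (xs ++ n ∷ [])                 ≡⟨ counts n ⟩
        suc n ∸ n                                     ≡⟨ m+n∸n≡m 1 n ⟩
        1                                             ∎
        where open ≡-Reasoning

    winnable2-appendLast-below : ∀ n x σ → x < n → IsPerm (suc n) σ → k₂ ≤ n →
      winnable2 (suc (suc n)) k₁ k₂ (appendLast (suc x) σ) ≡ winnable2 (suc n) k₁ k₂ σ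
    winnable2-appendLast-below n x σ x<n σ-perm k₂≤n =
      trans (winnable2-appendLast (suc (suc n)) (suc x) σ)
            (trans (compare (select [] 1 σ) refl) (sym (winnable2-holds (suc n) σ)))
      where
      compare : ∀ s → select [] 1 σ ≡ s →
        holds (suc n) (mapMaybe (bump (suc x)) s <∣> just (suc x)) ≡ holds n (s <∣> lastMaybe σ)
      compare (just v) _ with v <? suc x
      ... | yes v<x rewrite bump-< v<x =
        trans (≡ᵇ-false (λ v≡ → <-irrefl v≡ (≤-trans v<x (m≤n⇒m≤1+n x<n))))
              (sym (≡ᵇ-false (λ v≡ → <-irrefl v≡ (<-≤-trans v<x x<n))))
      ... | no  v≮x rewrite bump-≥ (≮⇒≥ v≮x) = refl
      compare nothing none =
        trans (≡ᵇ-false (λ x≡n → <-irrefl (cong suc x≡n) (s≤s x<n))) (sym (unselected-last n σ σ-perm k₂≤n none))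

    winnable2-appendLast-secondLargest : ∀ n σ →
      winnable2 (suc (suc n)) k₁ k₂ (appendLast (suc n) σ) ≡ not (pickable2 k₁ k₂ σ)
    winnable2-appendLast-secondLargest n σ = trans (winnable2-appendLast (suc (suc n)) (suc n) σ) (compare (select [] 1 σ))
      where
      compare : ∀ s → holds (suc n) (mapMaybe (bump (suc n)) s <∣> just (suc n)) ≡ not (is-just s)
      compare nothing = ≡ᵇ-true {suc n} refl
      compare (just v) with v <? suc n
      ... | yes v<n rewrite bump-< v<n = ≡ᵇ-false (λ v≡ → <-irrefl v≡ v<n)
      ... | no  v≮n rewrite bump-≥ (≮⇒≥ v≮n) = ≡ᵇ-false (λ v≡ → <-irrefl (sym v≡) (≮⇒≥ v≮n))

    winnable2-appendLast-largest : ∀ n σ →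
      winnable2 (suc (suc n)) k₁ k₂ (appendLast (suc (suc n)) σ) ≡ holds (suc n) (select [] 1 σ)
    winnable2-appendLast-largest n σ = trans (winnable2-appendLast (suc (suc n)) (suc (suc n)) σ) (compare (select [] 1 σ))
      where
      compare : ∀ s → holds (suc n) (mapMaybe (bump (suc (suc n))) s <∣> just (suc (suc n))) ≡ holds (suc n) s
      compare nothing = ≡ᵇ-false {suc (suc n)} {suc n} (λ eq → <-irrefl (sym eq) ≤-refl)
      compare (just v) with v <? suc (suc n)
      ... | yes v<n rewrite bump-< v<n = refl
      ... | no  v≮n rewrite bump-≥ (≮⇒≥ v≮n) =
        trans (≡ᵇ-false (λ eq → <-irrefl (sym eq) (≤-trans (n≤1+n _) (≮⇒≥ v≮n))))
              (sym (≡ᵇ-false (λ eq → <-irrefl (sym eq) (≮⇒≥ v≮n))))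

    holds-select-bounded : ∀ n prefix i xs → All (_≤ n) xs → holds (suc n) (select prefix i xs) ≡ false
    holds-select-bounded n prefix i xs bounded with select prefix i xs in eq
    ... | nothing = refl
    ... | just v  = ≡ᵇ-false (λ v≡ → <-irrefl v≡ (s≤s (select-All prefix i xs bounded eq)))

    holds-select-insertMax : ∀ n τ j → All (_≤ n) τ → j ≤ length τ →
      holds (suc n) (select [] 1 (insertAt j (suc n) τ)) ≡ (k₁ <ᵇ suc j) ∧ not (pickable2 k₁ k₂ (take j τ))
    holds-select-insertMax n τ j bounded j≤
      rewrite select-++ [] 1 (take j τ) (suc n ∷ drop j τ) with select [] 1 (take j τ) in eq
    ... | just v = trans (≡ᵇ-false (λ v≡ → <-irrefl v≡ (s≤s (select-All [] 1 (take j τ) (All.take⁺ j bounded) eq))))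
                         (sym (∧-zeroʳ (k₁ <ᵇ suc j)))
    ... | nothing
      rewrite select-LRMax (take j τ ʳ++ []) (length (take j τ) +ℕ 1) (suc n) (drop j τ)
                (greaterCount-ʳ++[]-all≤ (suc n) (take j τ) (All.take⁺ j (All.map m≤n⇒m≤1+n bounded)))
            | length-take≤ j τ j≤ | +-comm j 1 | ∧-identityʳ (k₁ <ᵇ suc j) with k₁ <ᵇ suc j
    ...   | true  = ≡ᵇ-true {suc n} refl
    ...   | false = holds-select-bounded n _ _ (drop j τ) (All.drop⁺ j bounded)

    -- Before position k₂ + 1 the strategy only looks for left-to-right maxima past k₁.
    pickable1≡pickable2 : ∀ xs → length xs ≤ k₂ → pickable1 k₁ xs ≡ pickable2 k₁ k₂ xs
    pickable1≡pickable2 xs len≤ = sym (go [] 1 xs (subst (_≤ suc k₂) (+-comm 1 (length xs)) (s≤s len≤)))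
      where
      go : ∀ prefix i xs → length xs +ℕ i ≤ suc k₂ → is-just (select prefix i xs) ≡ pick1 k₁ prefix i xs
      go prefix i []       _         = refl
      go prefix i (x ∷ xs) (s≤s le) rewrite <ᵇ-false {k₂} {i} (≤-trans (m≤n+m i (length xs)) le)
        with (k₁ <ᵇ i) ∧ isLRMax prefix x
      ... | true  = refl
      ... | false = go (x ∷ prefix) (suc i) xs (subst (_≤ suc k₂) (sym (+-suc (length xs) i)) (s≤s le))

  ∸-+-suc∸-comm : ∀ {n x j} → x ≤ n → j ≤ n → (n ∸ j) +ℕ (suc n ∸ x) ≡ (n ∸ x) +ℕ (suc n ∸ j)
  ∸-+-suc∸-comm {n} {x} {j} x≤n j≤n = begin
    (n ∸ j) +ℕ (suc n ∸ x)  ≡⟨ cong ((n ∸ j) +ℕ_) (+-∸-assoc 1 x≤n) ⟩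
    (n ∸ j) +ℕ suc (n ∸ x)  ≡⟨ +-suc (n ∸ j) (n ∸ x) ⟩
    suc (n ∸ j) +ℕ (n ∸ x)  ≡⟨ +-comm (suc (n ∸ j)) (n ∸ x) ⟩
    (n ∸ x) +ℕ suc (n ∸ j)  ≡⟨ cong ((n ∸ x) +ℕ_) (+-∸-assoc 1 j≤n) ⟨
    (n ∸ x) +ℕ (suc n ∸ j)  ∎
    where open ≡-Reasoning

  suc∸∸1 : ∀ n j → suc n ∸ j ∸ 1 ≡ n ∸ j
  suc∸∸1 n j = trans (∸-+-assoc (suc n) j 1) (cong (suc n ∸_) (+-comm j 1))

open Combinatorics

module Sums {c ℓ : Level} (R : CommutativeSemiring c ℓ) where
  open CommutativeSemiring R hiding (zero)
  open import Algebra.Properties.Semiring.Sum semiring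
    using (sum; sum-cong-≋; ∑-distrib-+; ∑-comm; *-distribˡ-sum; *-distribʳ-sum; sum-init-last; sum-replicate-zero)
  import Algebra.Properties.CommutativeSemigroup +-commutativeSemigroup as +-CS
  open import Relation.Binary.Reasoning.Setoid setoid

  -- Opaque, so that unification treats ∑< n f as rigid and can solve for f.
  opaque
    ∑< : ℕ → (ℕ → Carrier) → Carrier
    ∑< n f = sum {n} (λ i → f (toℕ i))

  opaque
    unfolding ∑<

    ∑<-0 : ∀ (f : ℕ → Carrier) → ∑< 0 f ≈ 0#
    ∑<-0 f = refl

    ∑<-head : ∀ n (f : ℕ → Carrier) → ∑< (suc n) f ≈ f 0 + ∑< n (λ i → f (suc i))
    ∑<-head n f = refl

    ∑<-cong : ∀ n {f g : ℕ → Carrier} → (∀ i → i < n → f i ≈ g i) → ∑< n f ≈ ∑< n g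
    ∑<-cong n f≈g = sum-cong-≋ {n} (λ i → f≈g (toℕ i) (toℕ<n i))

    ∑<-+ : ∀ n (f g : ℕ → Carrier) → ∑< n (λ i → f i + g i) ≈ ∑< n f + ∑< n g
    ∑<-+ n f g = ∑-distrib-+ {n} (λ i → f (toℕ i)) (λ i → g (toℕ i))

    ∑<-*ˡ : ∀ n x (f : ℕ → Carrier) → ∑< n (λ i → x * f i) ≈ x * ∑< n f
    ∑<-*ˡ n x f = sym (*-distribˡ-sum {n} x (λ i → f (toℕ i)))

    ∑<-*ʳ : ∀ n x (f : ℕ → Carrier) → ∑< n (λ i → f i * x) ≈ ∑< n f * x
    ∑<-*ʳ n x f = sym (*-distribʳ-sum {n} x (λ i → f (toℕ i)))

    ∑<-comm : ∀ m n (f : ℕ → ℕ → Carrier) → ∑< m (λ i → ∑< n (f i)) ≈ ∑< n (λ j → ∑< m (λ i → f i j))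
    ∑<-comm m n f = ∑-comm {m} {n} (λ i j → f (toℕ i) (toℕ j))

    ∑<-zero : ∀ n (f : ℕ → Carrier) → (∀ i → i < n → f i ≈ 0#) → ∑< n f ≈ 0#
    ∑<-zero n f f≈0 = trans (∑<-cong n f≈0) (sum-replicate-zero n)

    ∑<-suc : ∀ n (f : ℕ → Carrier) → ∑< (suc n) f ≈ ∑< n f + f n
    ∑<-suc n f = begin
      ∑< (suc n) f
        ≈⟨ sum-init-last {n} (λ i → f (toℕ i)) ⟩
      sum {n} (λ i → f (toℕ (inject₁ i))) + f (toℕ (fromℕ n))
        ≈⟨ +-cong (sum-cong-≋ {n} (λ i → reflexive (≡.cong f (toℕ-inject₁ i)))) (reflexive (≡.cong f (toℕ-fromℕ n))) ⟩
      ∑< n f + f n ∎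

    ∑<-+ℕ : ∀ a b (f : ℕ → Carrier) → ∑< (a +ℕ b) f ≈ ∑< a f + ∑< b (λ i → f (a +ℕ i))
    ∑<-+ℕ zero    b f = sym (+-identityˡ _)
    ∑<-+ℕ (suc a) b f = trans (+-cong refl (∑<-+ℕ a b (λ i → f (suc i)))) (sym (+-assoc _ _ _))

  ∑ₗ : {A : Set} → (A → Carrier) → List A → Carrier
  ∑ₗ f []       = 0#
  ∑ₗ f (a ∷ as) = f a + ∑ₗ f as

  ∑ₗ-cong : ∀ {A : Set} {f g : A → Carrier} xs → (∀ a → f a ≈ g a) → ∑ₗ f xs ≈ ∑ₗ g xs
  ∑ₗ-cong []       f≈g = refl
  ∑ₗ-cong (a ∷ as) f≈g = +-cong (f≈g a) (∑ₗ-cong as f≈g)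

  ∑ₗ-congAll : ∀ {A : Set} {P : A → Set} {f g : A → Carrier} xs → All P xs →
               (∀ a → P a → f a ≈ g a) → ∑ₗ f xs ≈ ∑ₗ g xs
  ∑ₗ-congAll []       []       f≈g = refl
  ∑ₗ-congAll (a ∷ as) (p ∷ ps) f≈g = +-cong (f≈g a p) (∑ₗ-congAll as ps f≈g)

  ∑ₗ-++ : ∀ {A : Set} (f : A → Carrier) xs ys → ∑ₗ f (xs ++ ys) ≈ ∑ₗ f xs + ∑ₗ f ys
  ∑ₗ-++ f []       ys = sym (+-identityˡ _)
  ∑ₗ-++ f (x ∷ xs) ys = trans (+-cong refl (∑ₗ-++ f xs ys)) (sym (+-assoc _ _ _))

  ∑ₗ-concatMap : ∀ {A B : Set} (f : B → Carrier) (g : A → List B) xs →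
                 ∑ₗ f (concatMap g xs) ≈ ∑ₗ (λ x → ∑ₗ f (g x)) xs
  ∑ₗ-concatMap f g []       = refl
  ∑ₗ-concatMap f g (x ∷ xs) = trans (∑ₗ-++ f (g x) (concatMap g xs)) (+-cong refl (∑ₗ-concatMap f g xs))

  ∑ₗ-map : ∀ {A B : Set} (f : B → Carrier) (g : A → B) xs → ∑ₗ f (map g xs) ≈ ∑ₗ (λ x → f (g x)) xs
  ∑ₗ-map f g []       = refl
  ∑ₗ-map f g (x ∷ xs) = +-cong refl (∑ₗ-map f g xs)

  ∑ₗ-+ : ∀ {A : Set} (f g : A → Carrier) xs → ∑ₗ (λ a → f a + g a) xs ≈ ∑ₗ f xs + ∑ₗ g xs
  ∑ₗ-+ f g []       = sym (+-identityˡ 0#)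
  ∑ₗ-+ f g (x ∷ xs) = trans (+-cong refl (∑ₗ-+ f g xs)) (+-CS.interchange _ _ _ _)

  ∑ₗ-zero : ∀ {A : Set} {f : A → Carrier} xs → (∀ a → f a ≈ 0#) → ∑ₗ f xs ≈ 0#
  ∑ₗ-zero []       f≈0 = refl
  ∑ₗ-zero (x ∷ xs) f≈0 = trans (+-cong (f≈0 x) (∑ₗ-zero xs f≈0)) (+-identityˡ 0#)

  ∑ₗ-*ˡ : ∀ {A : Set} x (f : A → Carrier) xs → ∑ₗ (λ a → x * f a) xs ≈ x * ∑ₗ f xs
  ∑ₗ-*ˡ x f []       = sym (zeroʳ x)
  ∑ₗ-*ˡ x f (y ∷ ys) = trans (+-cong refl (∑ₗ-*ˡ x f ys)) (sym (distribˡ x _ _))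

  ∑ₗ-∑< : ∀ {A : Set} n (f : A → ℕ → Carrier) xs → ∑ₗ (λ a → ∑< n (f a)) xs ≈ ∑< n (λ i → ∑ₗ (λ a → f a i) xs)
  ∑ₗ-∑< n f []       = sym (∑<-zero n _ (λ _ _ → refl))
  ∑ₗ-∑< n f (x ∷ xs) = trans (+-cong refl (∑ₗ-∑< n f xs)) (sym (∑<-+ n (f x) (λ i → ∑ₗ (λ a → f a i) xs)))

module Weighted {c ℓ : Level} (R : CommutativeSemiring c ℓ) (θ : CommutativeSemiring.Carrier R) where
  open CommutativeSemiring R hiding (zero)
  open GF R θ
  open Sums R
  import Algebra.Properties.CommutativeSemigroup *-commutativeSemigroup as *-CS
  open import Relation.Binary.Reasoning.Setoid setoid

  𝟙 : Bool → Carrier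
  𝟙 true  = 1#
  𝟙 false = 0#

  𝟙-∧ : ∀ b d → 𝟙 (b ∧ d) ≈ 𝟙 b * 𝟙 d
  𝟙-∧ true  d = sym (*-identityˡ _)
  𝟙-∧ false d = sym (zeroˡ _)

  sumIf≈∑ₗ : ∀ {A : Set} (p : A → Bool) f xs → sumIf p f xs ≈ ∑ₗ (λ a → f a * 𝟙 (p a)) xs
  sumIf≈∑ₗ p f []       = refl
  sumIf≈∑ₗ p f (a ∷ as) = +-cong (guard (p a)) (sumIf≈∑ₗ p f as)
    where
    guard : ∀ b → (if b then f a else 0#) ≈ f a * 𝟙 b
    guard true  = sym (*-identityʳ (f a))
    guard false = sym (zeroʳ (f a))

  pow-+ : ∀ a b → pow (a +ℕ b) ≈ pow a * pow b
  pow-+ zero    b = sym (*-identityˡ (pow b))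
  pow-+ (suc a) b = trans (*-cong refl (pow-+ a b)) (sym (*-assoc θ (pow a) (pow b)))

  weight : List ℕ → Carrier
  weight π = pow (inv π)

  ∑ₗ-insertions : ∀ (h : List ℕ → Carrier) a xs →
    ∑ₗ h (insertions a xs) ≈ ∑< (suc (length xs)) (λ j → h (insertAt j a xs))
  ∑ₗ-insertions h a []       =
    trans (+-cong refl (sym (∑<-0 _))) (sym (∑<-head 0 (λ j → h (insertAt j a []))))
  ∑ₗ-insertions h a (x ∷ xs) = trans
    (+-cong refl (trans (∑ₗ-map h (x ∷_) (insertions a xs)) (∑ₗ-insertions (λ zs → h (x ∷ zs)) a xs)))
    (sym (∑<-head (suc (length xs)) (λ j → h (insertAt j a (x ∷ xs)))))

  weight-insertMax : ∀ n τ j → IsPerm n τ → weight (insertAt j (suc n) τ) ≈ pow (n ∸ j) * weight τ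
  weight-insertMax n τ j (len , bounded , _) = trans
    (reflexive (≡.cong pow (≡.trans (inv-insertAt j (suc n) τ (All.map s≤s bounded))
                                    (≡.cong (λ m → (m ∸ j) +ℕ inv τ) len))))
    (pow-+ (n ∸ j) (inv τ))

  -- Inserting n + 1 at position j + 1 of τ ∈ S_n creates n ∸ j inversions.
  ∑-perms-insertMax : ∀ n (h : List ℕ → Carrier) →
    ∑ₗ (λ π → weight π * h π) (perms (suc n)) ≈
    ∑ₗ (λ τ → ∑< (suc n) (λ j → pow (n ∸ j) * (weight τ * h (insertAt j (suc n) τ)))) (perms n)
  ∑-perms-insertMax n h =
    trans (∑ₗ-concatMap _ (insertions (suc n)) (perms n)) (∑ₗ-congAll (perms n) (perms-IsPerm n) expand)
    where
    expand : ∀ τ → IsPerm n τ → ∑ₗ (λ π → weight π * h π) (insertions (suc n) τ) ≈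
             ∑< (suc n) (λ j → pow (n ∸ j) * (weight τ * h (insertAt j (suc n) τ)))
    expand τ τ-perm@(len , _ , _) with ∑ₗ-insertions (λ π → weight π * h π) (suc n) τ
    ... | eq rewrite len = trans eq (∑<-cong (suc n) λ j _ →
      trans (*-cong (weight-insertMax n τ j τ-perm) refl) (*-assoc (pow (n ∸ j)) (weight τ) (h (insertAt j (suc n) τ))))

  *-pow-*-pow : ∀ a b w y → pow a * (w * (pow b * y)) ≈ pow (a +ℕ b) * (w * y)
  *-pow-*-pow a b w y = begin
    pow a * (w * (pow b * y))  ≈⟨ *-cong refl (*-CS.x∙yz≈y∙xz w (pow b) y) ⟩
    pow a * (pow b * (w * y))  ≈⟨ *-assoc (pow a) (pow b) (w * y) ⟨
    (pow a * pow b) * (w * y)  ≈⟨ *-cong (pow-+ a b) refl ⟨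
    pow (a +ℕ b) * (w * y)     ∎

  *-*-∑< : ∀ n x y (f : ℕ → Carrier) → x * (y * ∑< n f) ≈ ∑< n (λ i → x * (y * f i))
  *-*-∑< n x y f = trans (*-cong refl (sym (∑<-*ˡ n y f))) (sym (∑<-*ˡ n x _))

  -- Relabel the last value of π ∈ S_{n+2} before or after inserting the maximum: the two orders
  -- give the same permutations, with θ-exponents (n ∸ x) + (n + 1 ∸ j) = (n ∸ j) + (n + 1 ∸ x).
  ∑-appendLast-insertMax : ∀ n (h : List ℕ → Carrier) →
    ∑ₗ (λ σ → ∑< (suc n) (λ x → pow (suc n ∸ x) * (weight σ * h (appendLast (suc x) σ)))) (perms (suc n)) ≈
    ∑ₗ (λ ρ → ∑< (suc n) (λ x → pow (n ∸ x) * (weight ρ *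
        ∑< (suc n) (λ j → pow (suc n ∸ j) * h (appendLast (suc x) (insertAt j (suc n) ρ)))))) (perms n)
  ∑-appendLast-insertMax n h = begin
    ∑ₗ (λ σ → ∑< (suc n) (λ x → pow (suc n ∸ x) * (weight σ * h (appendLast (suc x) σ)))) (perms (suc n))
      ≈⟨ ∑ₗ-cong (perms (suc n)) (λ σ → trans (∑<-cong (suc n) (λ x _ → *-CS.x∙yz≈y∙xz _ _ _)) (∑<-*ˡ (suc n) (weight σ) _)) ⟩
    ∑ₗ (λ σ → weight σ * K σ) (perms (suc n))
      ≈⟨ ∑-perms-insertMax n K ⟩
    ∑ₗ (λ ρ → ∑< (suc n) (λ j → pow (n ∸ j) * (weight ρ * K (insertAt j (suc n) ρ)))) (perms n)
      ≈⟨ ∑ₗ-cong (perms n) (λ ρ → ∑<-cong (suc n) (λ j _ → *-*-∑< (suc n) (pow (n ∸ j)) (weight ρ) _)) ⟩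
    ∑ₗ (λ ρ → ∑< (suc n) (λ j → ∑< (suc n) (λ x → pow (n ∸ j) * (weight ρ * (pow (suc n ∸ x) * h′ ρ x j))))) (perms n)
      ≈⟨ ∑ₗ-cong (perms n) (λ ρ → ∑<-cong (suc n) (λ j j≤ → ∑<-cong (suc n) (λ x x≤ → swapExponents ρ x j (ℕ.≤-pred x≤) (ℕ.≤-pred j≤)))) ⟩
    ∑ₗ (λ ρ → ∑< (suc n) (λ j → ∑< (suc n) (λ x → pow (n ∸ x) * (weight ρ * (pow (suc n ∸ j) * h′ ρ x j))))) (perms n)
      ≈⟨ ∑ₗ-cong (perms n) (λ ρ → ∑<-comm (suc n) (suc n) _) ⟩
    ∑ₗ (λ ρ → ∑< (suc n) (λ x → ∑< (suc n) (λ j → pow (n ∸ x) * (weight ρ * (pow (suc n ∸ j) * h′ ρ x j))))) (perms n)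
      ≈⟨ ∑ₗ-cong (perms n) (λ ρ → ∑<-cong (suc n) (λ x _ → sym (*-*-∑< (suc n) (pow (n ∸ x)) (weight ρ) _))) ⟩
    ∑ₗ (λ ρ → ∑< (suc n) (λ x → pow (n ∸ x) * (weight ρ * ∑< (suc n) (λ j → pow (suc n ∸ j) * h′ ρ x j)))) (perms n)
      ∎
    where
    K : List ℕ → Carrier
    K σ = ∑< (suc n) (λ x → pow (suc n ∸ x) * h (appendLast (suc x) σ))
    h′ : List ℕ → ℕ → ℕ → Carrier
    h′ ρ x j = h (appendLast (suc x) (insertAt j (suc n) ρ))
    swapExponents : ∀ ρ x j → x ≤ n → j ≤ n →
      pow (n ∸ j) * (weight ρ * (pow (suc n ∸ x) * h′ ρ x j)) ≈ pow (n ∸ x) * (weight ρ * (pow (suc n ∸ j) * h′ ρ x j))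
    swapExponents ρ x j x≤n j≤n = begin
      pow (n ∸ j) * (weight ρ * (pow (suc n ∸ x) * h′ ρ x j))  ≈⟨ *-pow-*-pow (n ∸ j) (suc n ∸ x) (weight ρ) _ ⟩
      pow ((n ∸ j) +ℕ (suc n ∸ x)) * (weight ρ * h′ ρ x j)     ≈⟨ *-cong (reflexive (≡.cong pow (∸-+-suc∸-comm x≤n j≤n))) refl ⟩
      pow ((n ∸ x) +ℕ (suc n ∸ j)) * (weight ρ * h′ ρ x j)     ≈⟨ *-pow-*-pow (n ∸ x) (suc n ∸ j) (weight ρ) _ ⟨
      pow (n ∸ x) * (weight ρ * (pow (suc n ∸ j) * h′ ρ x j))  ∎

  ∑-insertMax-appendLast : ∀ n x ρ (h : List ℕ → Carrier) → length ρ ≡ n → x ≤ n →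
    ∑< (suc (suc n)) (λ j → pow (suc n ∸ j) * h (insertAt j (suc (suc n)) (appendLast (suc x) ρ))) ≈
    ∑< (suc n) (λ j → pow (suc n ∸ j) * h (appendLast (suc x) (insertAt j (suc n) ρ)))
      + h (appendLast (suc x) ρ ++ suc (suc n) ∷ [])
  ∑-insertMax-appendLast n x ρ h len x≤n = trans (∑<-suc (suc n) _) (+-cong
    (∑<-cong (suc n) (λ j j< → *-cong refl (reflexive (≡.cong h (appendLast-insertAt n x j ρ len x≤n (ℕ.≤-pred j<))))))
    (trans (*-cong (reflexive (≡.cong pow (ℕ.n∸n≡0 (suc n)))) (reflexive (≡.cong h insertLast))) (*-identityˡ _)))
    where
    insertLast : insertAt (suc n) (suc (suc n)) (appendLast (suc x) ρ) ≡ appendLast (suc x) ρ ++ suc (suc n) ∷ []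
    insertLast = ≡.subst (λ m → insertAt m (suc (suc n)) (appendLast (suc x) ρ) ≡ appendLast (suc x) ρ ++ suc (suc n) ∷ [])
                         (≡.trans (length-appendLast (suc x) ρ) (≡.cong suc len))
                         (insertAt-length (suc (suc n)) (appendLast (suc x) ρ))

  -- Every π ∈ S_{n+1} is appendLast (x + 1) σ for exactly one σ ∈ S_n and x ≤ n, with
  -- inv π = (n ∸ x) + inv σ. Rather than building this bijection, induct on n, expanding both
  -- sides along the insertion of the maximum and commuting the two constructions.
  ∑-perms-appendLast : ∀ n (h : List ℕ → Carrier) →
    ∑ₗ (λ π → weight π * h π) (perms (suc n)) ≈
    ∑ₗ (λ σ → ∑< (suc n) (λ x → pow (n ∸ x) * (weight σ * h (appendLast (suc x) σ)))) (perms n)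
  ∑-perms-appendLast zero h = +-cong (sym (begin
    ∑< 1 (λ x → pow (0 ∸ x) * (1# * h (appendLast (suc x) [])))  ≈⟨ ∑<-head 0 _ ⟩
    1# * (1# * h (1 ∷ [])) + ∑< 0 _                     ≈⟨ +-cong refl (∑<-0 _) ⟩
    1# * (1# * h (1 ∷ [])) + 0#                         ≈⟨ +-identityʳ _ ⟩
    1# * (1# * h (1 ∷ []))                              ≈⟨ *-identityˡ _ ⟩
    1# * h (1 ∷ [])                                     ∎)) refl
  ∑-perms-appendLast (suc n) h = begin
    ∑ₗ (λ π → weight π * h π) (perms (suc (suc n)))
      ≈⟨ ∑-perms-insertMax (suc n) h ⟩
    ∑ₗ (λ τ → ∑< (suc (suc n)) (λ j → pow (suc n ∸ j) * (weight τ * h (insertAt j a τ)))) (perms (suc n))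
      ≈⟨ ∑ₗ-cong (perms (suc n)) (λ τ → trans (∑<-cong (suc (suc n)) (λ j _ → *-CS.x∙yz≈y∙xz _ _ _))
                                              (∑<-*ˡ (suc (suc n)) (weight τ) _)) ⟩
    ∑ₗ (λ τ → weight τ * H τ) (perms (suc n))
      ≈⟨ ∑-perms-appendLast n H ⟩
    ∑ₗ (λ ρ → ∑< (suc n) (λ x → pow (n ∸ x) * (weight ρ * H (appendLast (suc x) ρ)))) (perms n)
      ≈⟨ ∑ₗ-congAll (perms n) (perms-IsPerm n) (λ ρ (len , _ , _) → ∑<-cong (suc n) (λ x x< →
           *-cong refl (*-cong refl (∑-insertMax-appendLast n x ρ h len (ℕ.≤-pred x<))))) ⟩
    ∑ₗ (λ ρ → ∑< (suc n) (λ x → pow (n ∸ x) * (weight ρ * (U ρ x + V ρ x)))) (perms n)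
      ≈⟨ ∑ₗ-cong (perms n) (λ ρ → trans (∑<-cong (suc n) (λ x _ → trans (*-cong refl (distribˡ _ _ _)) (distribˡ _ _ _)))
                                         (∑<-+ (suc n) _ _)) ⟩
    ∑ₗ (λ ρ → ∑< (suc n) (λ x → pow (n ∸ x) * (weight ρ * U ρ x)) + ∑< (suc n) (λ x → pow (n ∸ x) * (weight ρ * V ρ x))) (perms n)
      ≈⟨ ∑ₗ-+ _ _ (perms n) ⟩
    ∑ₗ (λ ρ → ∑< (suc n) (λ x → pow (n ∸ x) * (weight ρ * U ρ x))) (perms n)
      + ∑ₗ (λ ρ → ∑< (suc n) (λ x → pow (n ∸ x) * (weight ρ * V ρ x))) (perms n)
      ≈⟨ +-cong (sym (∑-appendLast-insertMax n h)) (sym (trans lastMax (∑-perms-appendLast n (λ σ → h (σ ++ a ∷ []))))) ⟩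
    ∑ₗ (λ σ → ∑< (suc n) (λ x → pow (suc n ∸ x) * (weight σ * h (appendLast (suc x) σ)))) (perms (suc n))
      + ∑ₗ (λ σ → pow (suc n ∸ suc n) * (weight σ * h (appendLast a σ))) (perms (suc n))
      ≈⟨ ∑ₗ-+ _ _ (perms (suc n)) ⟨
    ∑ₗ (λ σ → ∑< (suc n) (λ x → pow (suc n ∸ x) * (weight σ * h (appendLast (suc x) σ)))
              + pow (suc n ∸ suc n) * (weight σ * h (appendLast a σ))) (perms (suc n))
      ≈⟨ ∑ₗ-cong (perms (suc n)) (λ σ → ∑<-suc (suc n) _) ⟨
    ∑ₗ (λ σ → ∑< (suc (suc n)) (λ x → pow (suc n ∸ x) * (weight σ * h (appendLast (suc x) σ)))) (perms (suc n)) ∎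
    where
    a : ℕ
    a = suc (suc n)
    H : List ℕ → Carrier
    H τ = ∑< (suc (suc n)) (λ j → pow (suc n ∸ j) * h (insertAt j a τ))
    U : List ℕ → ℕ → Carrier
    U ρ x = ∑< (suc n) (λ j → pow (suc n ∸ j) * h (appendLast (suc x) (insertAt j (suc n) ρ)))
    V : List ℕ → ℕ → Carrier
    V ρ x = h (appendLast (suc x) ρ ++ a ∷ [])
    lastMax : ∑ₗ (λ σ → pow (suc n ∸ suc n) * (weight σ * h (appendLast a σ))) (perms (suc n)) ≈
              ∑ₗ (λ σ → weight σ * h (σ ++ a ∷ [])) (perms (suc n))
    lastMax = ∑ₗ-congAll (perms (suc n)) (perms-IsPerm (suc n)) λ σ (_ , bounded , _) →
      trans (*-cong (reflexive (≡.cong pow (ℕ.n∸n≡0 n))) (*-cong refl (reflexive (≡.cong h (appendLast-max (suc n) σ bounded)))))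
            (*-identityˡ _)

  P-suc : ∀ q → P (suc q) ≈ 1# + θ * P q
  P-suc zero    = trans (+-identityˡ 1#) (sym (trans (+-cong refl (zeroʳ θ)) (+-identityʳ 1#)))
  P-suc (suc q) = begin
    P (suc q) + pow (suc q)       ≈⟨ +-cong (P-suc q) refl ⟩
    (1# + θ * P q) + θ * pow q    ≈⟨ +-assoc _ _ _ ⟩
    1# + (θ * P q + θ * pow q)    ≈⟨ +-cong refl (distribˡ θ (P q) (pow q)) ⟨
    1# + θ * P (suc q)            ∎

  P-+ : ∀ p q → P (p +ℕ q) ≈ P p + pow p * P q
  P-+ zero    q = sym (trans (+-identityˡ _) (*-identityˡ _))
  P-+ (suc p) q = begin
    P (p +ℕ q) + pow (p +ℕ q)                  ≈⟨ +-cong (P-+ p q) (pow-+ p q) ⟩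
    (P p + pow p * P q) + pow p * pow q        ≈⟨ +-assoc _ _ _ ⟩
    P p + (pow p * P q + pow p * pow q)        ≈⟨ +-cong refl (distribˡ (pow p) (P q) (pow q)) ⟨
    P p + pow p * P (suc q)                    ≈⟨ +-cong refl (*-cong refl (P-suc q)) ⟩
    P p + pow p * (1# + θ * P q)               ≈⟨ +-cong refl (distribˡ (pow p) 1# (θ * P q)) ⟩
    P p + (pow p * 1# + pow p * (θ * P q))     ≈⟨ +-cong refl (+-cong (*-identityʳ _) (*-CS.x∙yz≈y∙xz (pow p) θ (P q))) ⟩
    P p + (pow p + θ * (pow p * P q))          ≈⟨ +-assoc _ _ _ ⟨
    (P p + pow p) + θ * (pow p * P q)          ≈⟨ +-cong refl (*-assoc θ (pow p) (P q)) ⟨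
    P (suc p) + pow (suc p) * P q              ∎

  qbinom : ℕ → ℕ → Carrier
  qbinom L n = ∑ₗ (λ bs → pow (crossB bs) * 𝟙 (trues bs ≡ᵇ n)) (boolLists L)

  B≈qbinom : ∀ a b → B a b ≈ qbinom (a +ℕ b) a
  B≈qbinom a b = sumIf≈∑ₗ (λ bs → trues bs ≡ᵇ a) (λ bs → pow (crossB bs)) (boolLists (a +ℕ b))

  -- Split on whether the first element lies in Π₁ or in Π₂; in the latter case it
  -- is smaller than all of Π₁, contributing θ^n.
  qbinom-suc : ∀ L n →
    qbinom (suc L) n ≈ ∑ₗ (λ bs → pow (crossB bs) * 𝟙 (suc (trues bs) ≡ᵇ n)) (boolLists L) + pow n * qbinom L n
  qbinom-suc L n = begin
    qbinom (suc L) n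
      ≈⟨ ∑ₗ-concatMap _ (λ bs → (true ∷ bs) ∷ (false ∷ bs) ∷ []) (boolLists L) ⟩
    ∑ₗ (λ bs → pow (crossB bs) * 𝟙 (suc (trues bs) ≡ᵇ n) + (pow (trues bs +ℕ crossB bs) * 𝟙 (trues bs ≡ᵇ n) + 0#)) (boolLists L)
      ≈⟨ ∑ₗ-cong (boolLists L) (λ bs → +-cong refl (trans (+-identityʳ _) (firstInΠ₂ (trues bs) (crossB bs)))) ⟩
    ∑ₗ (λ bs → pow (crossB bs) * 𝟙 (suc (trues bs) ≡ᵇ n) + pow n * (pow (crossB bs) * 𝟙 (trues bs ≡ᵇ n))) (boolLists L)
      ≈⟨ ∑ₗ-+ _ _ (boolLists L) ⟩
    _ + ∑ₗ (λ bs → pow n * (pow (crossB bs) * 𝟙 (trues bs ≡ᵇ n))) (boolLists L)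
      ≈⟨ +-cong refl (∑ₗ-*ˡ (pow n) _ (boolLists L)) ⟩
    _ ∎
    where
    firstInΠ₂ : ∀ t e → pow (t +ℕ e) * 𝟙 (t ≡ᵇ n) ≈ pow n * (pow e * 𝟙 (t ≡ᵇ n))
    firstInΠ₂ t e with t ≡ᵇ n in eq
    ... | false = trans (zeroʳ _) (sym (trans (*-cong refl (zeroʳ _)) (zeroʳ _)))
    ... | true rewrite ℕ.≡ᵇ⇒≡ t n (≡.subst T (≡.sym eq) _) = trans (*-cong (pow-+ n e) refl) (*-assoc _ _ _)

  qbinom-zero : ∀ L → qbinom L 0 ≈ 1#
  qbinom-zero zero    = trans (+-identityʳ _) (*-identityˡ 1#)
  qbinom-zero (suc L) = trans (qbinom-suc L 0)
    (trans (+-cong (∑ₗ-zero (boolLists L) (λ bs → zeroʳ _)) (trans (*-identityˡ _) (qbinom-zero L))) (+-identityˡ 1#))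

  qbinom-> : ∀ L n → L < n → qbinom L n ≈ 0#
  qbinom-> zero    (suc n) _           = trans (+-identityʳ _) (zeroʳ _)
  qbinom-> (suc L) (suc n) (s≤s L<n) = trans (qbinom-suc L (suc n))
    (trans (+-cong (qbinom-> L n L<n) (trans (*-cong refl (qbinom-> L (suc n) (ℕ.m<n⇒m<1+n L<n))) (zeroʳ _))) (+-identityˡ 0#))

  qbinom-diag : ∀ L → qbinom L L ≈ 1#
  qbinom-diag zero    = qbinom-zero 0
  qbinom-diag (suc L) = trans (qbinom-suc L (suc L))
    (trans (+-cong (qbinom-diag L) (trans (*-cong refl (qbinom-> L (suc L) (ℕ.n<1+n L))) (zeroʳ _))) (+-identityʳ 1#))

  B-zeroˡ : ∀ b → B 0 b ≈ 1#
  B-zeroˡ b = trans (B≈qbinom 0 b) (qbinom-zero b)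

  B-zeroʳ : ∀ a → B a 0 ≈ 1#
  B-zeroʳ a = trans (B≈qbinom a 0) (trans (reflexive (≡.cong (λ L → qbinom L a) (ℕ.+-identityʳ a))) (qbinom-diag a))

  B-suc-suc : ∀ a b → B (suc a) (suc b) ≈ B a (suc b) + pow (suc a) * B (suc a) b
  B-suc-suc a b = begin
    B (suc a) (suc b)                                        ≈⟨ B≈qbinom (suc a) (suc b) ⟩
    qbinom (suc (a +ℕ suc b)) (suc a)                        ≈⟨ qbinom-suc (a +ℕ suc b) (suc a) ⟩
    qbinom (a +ℕ suc b) a + pow (suc a) * qbinom (a +ℕ suc b) (suc a)
      ≈⟨ +-cong (sym (B≈qbinom a (suc b))) (*-cong refl (reflexive (≡.cong (λ L → qbinom L (suc a)) (ℕ.+-suc a b)))) ⟩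
    B a (suc b) + pow (suc a) * qbinom (suc a +ℕ b) (suc a)  ≈⟨ +-cong refl (*-cong refl (sym (B≈qbinom (suc a) b))) ⟩
    B a (suc b) + pow (suc a) * B (suc a) b                  ∎

  -- q-analogues of (a+b+1 choose a)·(b+1) = (a+b+1)·(a+b choose a) and of its mirror image.
  mutual
    B-*-Pʳ : ∀ a b → B a (suc b) * P (suc b) ≈ P (suc (a +ℕ b)) * B a b
    B-*-Pʳ zero    b = begin
      B 0 (suc b) * P (suc b)  ≈⟨ *-cong (B-zeroˡ (suc b)) refl ⟩
      1# * P (suc b)           ≈⟨ *-identityˡ _ ⟩
      P (suc b)                ≈⟨ *-identityʳ _ ⟨
      P (suc b) * 1#           ≈⟨ *-cong refl (B-zeroˡ b) ⟨
      P (suc b) * B 0 b        ∎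
    B-*-Pʳ (suc a) b = begin
      B (suc a) (suc b) * P (suc b)
        ≈⟨ *-cong (B-suc-suc a b) refl ⟩
      (B a (suc b) + pow (suc a) * B (suc a) b) * P (suc b)
        ≈⟨ distribʳ _ _ _ ⟩
      B a (suc b) * P (suc b) + (pow (suc a) * B (suc a) b) * P (suc b)
        ≈⟨ +-cong (B-*-Pʳ a b) (*-CS.xy∙z≈x∙zy _ _ _) ⟩
      P (suc (a +ℕ b)) * B a b + pow (suc a) * (P (suc b) * B (suc a) b)
        ≈⟨ +-cong (sym (P-*-Bˡ a b)) (sym (*-assoc _ _ _)) ⟩
      P (suc a) * B (suc a) b + (pow (suc a) * P (suc b)) * B (suc a) b
        ≈⟨ distribʳ _ _ _ ⟨
      (P (suc a) + pow (suc a) * P (suc b)) * B (suc a) b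
        ≈⟨ *-cong (P-+ (suc a) (suc b)) refl ⟨
      P (suc a +ℕ suc b) * B (suc a) b
        ≈⟨ reflexive (≡.cong (λ m → P (suc m) * B (suc a) b) (ℕ.+-suc a b)) ⟩
      P (suc (suc a +ℕ b)) * B (suc a) b ∎

    P-*-Bˡ : ∀ a b → P (suc a) * B (suc a) b ≈ P (suc a +ℕ b) * B a b
    P-*-Bˡ a zero = begin
      P (suc a) * B (suc a) 0     ≈⟨ *-cong (reflexive (≡.cong P (≡.sym (ℕ.+-identityʳ (suc a))))) (B-zeroʳ (suc a)) ⟩
      P (suc a +ℕ 0) * 1#         ≈⟨ *-cong refl (B-zeroʳ a) ⟨
      P (suc a +ℕ 0) * B a 0      ∎
    P-*-Bˡ a (suc b) = begin
      P (suc a) * B (suc a) (suc b)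
        ≈⟨ *-cong refl (B-suc-suc a b) ⟩
      P (suc a) * (B a (suc b) + pow (suc a) * B (suc a) b)
        ≈⟨ distribˡ _ _ _ ⟩
      P (suc a) * B a (suc b) + P (suc a) * (pow (suc a) * B (suc a) b)
        ≈⟨ +-cong refl (*-CS.x∙yz≈y∙xz _ _ _) ⟩
      P (suc a) * B a (suc b) + pow (suc a) * (P (suc a) * B (suc a) b)
        ≈⟨ +-cong refl (*-cong refl (P-*-Bˡ a b)) ⟩
      P (suc a) * B a (suc b) + pow (suc a) * (P (suc (a +ℕ b)) * B a b)
        ≈⟨ +-cong refl (*-cong refl (trans (sym (B-*-Pʳ a b)) (*-comm _ _))) ⟩
      P (suc a) * B a (suc b) + pow (suc a) * (P (suc b) * B a (suc b))
        ≈⟨ +-cong refl (sym (*-assoc _ _ _)) ⟩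
      P (suc a) * B a (suc b) + (pow (suc a) * P (suc b)) * B a (suc b)
        ≈⟨ distribʳ _ _ _ ⟨
      (P (suc a) + pow (suc a) * P (suc b)) * B a (suc b)
        ≈⟨ *-cong (P-+ (suc a) (suc b)) refl ⟨
      P (suc a +ℕ suc b) * B a (suc b) ∎

  ∑<-pow≈P : ∀ n → ∑< (suc n) (λ x → pow (n ∸ x)) ≈ P (suc n)
  ∑<-pow≈P zero    = trans (∑<-head 0 _) (trans (+-cong refl (∑<-0 _)) (trans (+-identityʳ _) (sym (+-identityˡ _))))
  ∑<-pow≈P (suc n) = trans (∑<-head (suc n) _) (trans (+-cong refl (∑<-pow≈P n)) (+-comm _ _))

  module _ (p : List ℕ → Bool) (p-bump : ∀ x xs → p (map (bump x) xs) ≡ p xs) where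

    -- Relative order is all p sees, so appending a last value leaves p of the prefix unchanged.
    ∑-perms-prefix : ∀ m k →
      ∑ₗ (λ τ → weight τ * 𝟙 (p (take m τ))) (perms (k +ℕ m)) ≈
      ∑ₗ (λ α → weight α * 𝟙 (p α)) (perms m) * (B m k * Pfact k)
    ∑-perms-prefix m zero = begin
      ∑ₗ (λ τ → weight τ * 𝟙 (p (take m τ))) (perms m)
        ≈⟨ ∑ₗ-congAll (perms m) (perms-IsPerm m) (λ τ (len , _ , _) →
             *-cong refl (reflexive (≡.cong (λ xs → 𝟙 (p xs)) (take-all m τ (ℕ.≤-reflexive len))))) ⟩
      ∑ₗ (λ α → weight α * 𝟙 (p α)) (perms m)
        ≈⟨ *-identityʳ _ ⟨
      ∑ₗ (λ α → weight α * 𝟙 (p α)) (perms m) * 1#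
        ≈⟨ *-cong refl (trans (*-cong (B-zeroʳ m) refl) (*-identityˡ 1#)) ⟨
      ∑ₗ (λ α → weight α * 𝟙 (p α)) (perms m) * (B m 0 * Pfact 0) ∎
    ∑-perms-prefix m (suc k) = begin
      ∑ₗ (λ τ → weight τ * 𝟙 (p (take m τ))) (perms (suc (k +ℕ m)))
        ≈⟨ ∑-perms-appendLast (k +ℕ m) (λ τ → 𝟙 (p (take m τ))) ⟩
      ∑ₗ (λ σ → ∑< (suc (k +ℕ m)) (λ x → pow ((k +ℕ m) ∸ x) * (weight σ * 𝟙 (p (take m (appendLast (suc x) σ)))))) (perms (k +ℕ m))
        ≈⟨ ∑ₗ-congAll (perms (k +ℕ m)) (perms-IsPerm (k +ℕ m)) (λ σ (len , _ , _) →
             trans (∑<-cong (suc (k +ℕ m)) (λ x _ → *-cong refl (*-cong refl (reflexive (prefix-appendLast σ x len)))))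
                   (∑<-*ʳ (suc (k +ℕ m)) _ _)) ⟩
      ∑ₗ (λ σ → ∑< (suc (k +ℕ m)) (λ x → pow ((k +ℕ m) ∸ x)) * (weight σ * 𝟙 (p (take m σ)))) (perms (k +ℕ m))
        ≈⟨ ∑ₗ-*ˡ _ _ (perms (k +ℕ m)) ⟩
      ∑< (suc (k +ℕ m)) (λ x → pow ((k +ℕ m) ∸ x)) * ∑ₗ (λ σ → weight σ * 𝟙 (p (take m σ))) (perms (k +ℕ m))
        ≈⟨ *-cong (∑<-pow≈P (k +ℕ m)) (∑-perms-prefix m k) ⟩
      P (suc (k +ℕ m)) * (Tₘ * (B m k * Pfact k))
        ≈⟨ *-CS.x∙yz≈y∙xz _ _ _ ⟩
      Tₘ * (P (suc (k +ℕ m)) * (B m k * Pfact k))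
        ≈⟨ *-cong refl (*-assoc _ _ _) ⟨
      Tₘ * ((P (suc (k +ℕ m)) * B m k) * Pfact k)
        ≈⟨ *-cong refl (*-cong (trans (reflexive (≡.cong (λ i → P (suc i) * B m k) (ℕ.+-comm k m))) (sym (B-*-Pʳ m k))) refl) ⟩
      Tₘ * ((B m (suc k) * P (suc k)) * Pfact k)
        ≈⟨ *-cong refl (*-assoc _ _ _) ⟩
      Tₘ * (B m (suc k) * Pfact (suc k)) ∎
      where
      Tₘ : Carrier
      Tₘ = ∑ₗ (λ α → weight α * 𝟙 (p α)) (perms m)
      prefix-appendLast : ∀ σ x → length σ ≡ k +ℕ m → 𝟙 (p (take m (appendLast (suc x) σ))) ≡ 𝟙 (p (take m σ))
      prefix-appendLast σ x len = ≡.cong 𝟙 (≡.trans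
        (≡.cong p (≡.trans (take-++ˡ m (map (bump (suc x)) σ) _ m≤) (take-map m σ)))
        (p-bump (suc x) (take m σ)))
        where
        m≤ : m ≤ length (map (bump (suc x)) σ)
        m≤ = ≡.subst (m ≤_) (≡.sym (≡.trans (length-map _ σ) len)) (ℕ.m≤n+m m k)

    ∑-perms-prefix≤ : ∀ m n → m ≤ n →
      ∑ₗ (λ τ → weight τ * 𝟙 (p (take m τ))) (perms n) ≈
      ∑ₗ (λ α → weight α * 𝟙 (p α)) (perms m) * (B m (n ∸ m) * Pfact (n ∸ m))
    ∑-perms-prefix≤ m n m≤n =
      trans (reflexive (≡.cong (λ l → ∑ₗ (λ τ → weight τ * 𝟙 (p (take m τ))) (perms l)) (≡.sym (ℕ.m∸n+n≡m m≤n))))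
            (∑-perms-prefix m (n ∸ m))

  ∑<-pow-suc : ∀ n → ∑< n (λ x → pow (suc n ∸ x)) ≈ pow 2 * P n
  ∑<-pow-suc zero    = trans (∑<-0 _) (sym (zeroʳ _))
  ∑<-pow-suc (suc n) = trans (∑<-head n _)
    (trans (+-cong (pow-+ 2 n) (∑<-pow-suc n)) (trans (+-comm _ _) (sym (distribˡ _ _ _))))

  sumFromTo≈∑< : ∀ a b (f : ℕ → Carrier) → sumFromTo (suc a) (suc b) f ≈ ∑< (suc b ∸ a) (λ t → f (suc (a +ℕ t)))
  sumFromTo≈∑< a b f = go (suc b ∸ a) a ≡.refl
    where
    go : ∀ m a → suc b ∸ a ≡ m → sumFromTo (suc a) (suc b) f ≈ ∑< m (λ t → f (suc (a +ℕ t)))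
    go zero    a empty rewrite empty = sym (∑<-0 _)
    go (suc m) a count with a ℕ.≤? b
    ... | no  a≰b = contradiction (≡.trans (≡.sym (ℕ.m≤n⇒m∸n≡0 (ℕ.≰⇒> a≰b))) count) ℕ.0≢1+n
    ... | yes a≤b = begin
      sumFromTo (suc a) (suc b) f                   ≡⟨ sumFromTo-head ⟩
      f (suc a) + sumFromTo (suc (suc a)) (suc b) f  ≈⟨ +-cong (reflexive (≡.cong (λ i → f (suc i)) (≡.sym (ℕ.+-identityʳ a))))
                                                              (go m (suc a) (ℕ.suc-injective (≡.trans (≡.sym count′) count))) ⟩
      f (suc (a +ℕ 0)) + ∑< m (λ t → f (suc (suc a +ℕ t)))
                                                    ≈⟨ +-cong refl (∑<-cong m (λ t _ → reflexive (≡.cong (λ i → f (suc i)) (≡.sym (ℕ.+-suc a t))))) ⟩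
      f (suc (a +ℕ 0)) + ∑< m (λ t → f (suc (a +ℕ suc t)))
                                                    ≈⟨ ∑<-head m _ ⟨
      ∑< (suc m) (λ t → f (suc (a +ℕ t)))           ∎
      where
      count′ : suc b ∸ a ≡ suc (b ∸ a)
      count′ = ℕ.+-∸-assoc 1 a≤b
      sumFromTo-head : sumFromTo (suc a) (suc b) f ≡ f (suc a) + sumFromTo (suc (suc a)) (suc b) f
      sumFromTo-head rewrite count′ = ≡.refl

  module Recurrence (k₁ k₂ : ℕ) where
    open Strategy k₁ k₂

    unpickable : List ℕ → Bool
    unpickable xs = not (pickable2 k₁ k₂ xs)

    T₁'≈∑ₗ : ∀ j → T₁' j k₁ k₂ ≈ ∑ₗ (λ α → weight α * 𝟙 (unpickable α)) (perms j)
    T₁'≈∑ₗ j = sumIf≈∑ₗ unpickable weight (perms j)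

    W₁≈∑ₗ : ∀ n → W₁ n k₁ k₂ ≈ ∑ₗ (λ π → weight π * 𝟙 (winnable2 n k₁ k₂ π)) (perms n)
    W₁≈∑ₗ n = sumIf≈∑ₗ (winnable2 n k₁ k₂) weight (perms n)

    T₁≈T₁' : ∀ j → j ≤ k₂ → T₁ j k₁ ≈ T₁' j k₁ k₂
    T₁≈T₁' j j≤k₂ = begin
      T₁ j k₁
        ≈⟨ sumIf≈∑ₗ (λ π → not (pickable1 k₁ π)) weight (perms j) ⟩
      ∑ₗ (λ π → weight π * 𝟙 (not (pickable1 k₁ π))) (perms j)
        ≈⟨ ∑ₗ-congAll (perms j) (perms-IsPerm j) (λ π (len , _ , _) →
             *-cong refl (reflexive (≡.cong (λ b → 𝟙 (not b)) (pickable1≡pickable2 π (≡.subst (_≤ k₂) (≡.sym len) j≤k₂))))) ⟩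
      ∑ₗ (λ π → weight π * 𝟙 (unpickable π)) (perms j)
        ≈⟨ T₁'≈∑ₗ j ⟨
      T₁' j k₁ k₂ ∎

    picksMax : ℕ → Carrier
    picksMax n = ∑ₗ (λ σ → weight σ * 𝟙 (holds (suc n) (select [] 1 σ))) (perms (suc n))

    ∑<-winnable2-appendLast : ∀ n σ → IsPerm (suc n) σ → k₂ ≤ n →
      ∑< (suc (suc n)) (λ x → pow (suc n ∸ x) * (weight σ * 𝟙 (winnable2 (suc (suc n)) k₁ k₂ (appendLast (suc x) σ)))) ≈
      (pow 2 * P n) * (weight σ * 𝟙 (winnable2 (suc n) k₁ k₂ σ)) + θ * (weight σ * 𝟙 (unpickable σ))
        + weight σ * 𝟙 (holds (suc n) (select [] 1 σ))
    ∑<-winnable2-appendLast n σ σ-perm k₂≤n = begin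
      ∑< (suc (suc n)) f             ≈⟨ ∑<-suc (suc n) f ⟩
      ∑< (suc n) f + f (suc n)       ≈⟨ +-cong (∑<-suc n f) refl ⟩
      (∑< n f + f n) + f (suc n)     ≈⟨ +-cong (+-cong below secondLargest) largest ⟩
      (pow 2 * P n) * (weight σ * 𝟙 (winnable2 (suc n) k₁ k₂ σ)) + θ * (weight σ * 𝟙 (unpickable σ))
        + weight σ * 𝟙 (holds (suc n) (select [] 1 σ)) ∎
      where
      f : ℕ → Carrier
      f x = pow (suc n ∸ x) * (weight σ * 𝟙 (winnable2 (suc (suc n)) k₁ k₂ (appendLast (suc x) σ)))
      below : ∑< n f ≈ (pow 2 * P n) * (weight σ * 𝟙 (winnable2 (suc n) k₁ k₂ σ))
      below = trans (∑<-cong n (λ x x<n → *-cong refl (*-cong refl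
                      (reflexive (≡.cong 𝟙 (winnable2-appendLast-below n x σ x<n σ-perm k₂≤n))))))
                    (trans (∑<-*ʳ n _ _) (*-cong (∑<-pow-suc n) refl))
      secondLargest : f n ≈ θ * (weight σ * 𝟙 (unpickable σ))
      secondLargest = *-cong (trans (reflexive (≡.cong pow (ℕ.m+n∸n≡m 1 n))) (*-identityʳ θ))
                             (*-cong refl (reflexive (≡.cong 𝟙 (winnable2-appendLast-secondLargest n σ))))
      largest : f (suc n) ≈ weight σ * 𝟙 (holds (suc n) (select [] 1 σ))
      largest = trans (*-cong (reflexive (≡.cong pow (ℕ.n∸n≡0 n)))
                              (*-cong refl (reflexive (≡.cong 𝟙 (winnable2-appendLast-largest n σ)))))
                      (*-identityˡ _)

    W₁-decomposition : ∀ n → k₂ ≤ n →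
      W₁ (suc (suc n)) k₁ k₂ ≈ pow 2 * P n * W₁ (suc n) k₁ k₂ + θ * T₁' (suc n) k₁ k₂ + picksMax n
    W₁-decomposition n k₂≤n = begin
      W₁ (suc (suc n)) k₁ k₂
        ≈⟨ W₁≈∑ₗ (suc (suc n)) ⟩
      ∑ₗ (λ π → weight π * 𝟙 (winnable2 (suc (suc n)) k₁ k₂ π)) (perms (suc (suc n)))
        ≈⟨ ∑-perms-appendLast (suc n) _ ⟩
      ∑ₗ (λ σ → ∑< (suc (suc n)) (λ x → pow (suc n ∸ x) * (weight σ * 𝟙 (winnable2 (suc (suc n)) k₁ k₂ (appendLast (suc x) σ)))))
         (perms (suc n))
        ≈⟨ ∑ₗ-congAll (perms (suc n)) (perms-IsPerm (suc n)) (λ σ σ-perm → ∑<-winnable2-appendLast n σ σ-perm k₂≤n) ⟩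
      ∑ₗ (λ σ → (pow 2 * P n) * (weight σ * 𝟙 (winnable2 (suc n) k₁ k₂ σ)) + θ * (weight σ * 𝟙 (unpickable σ))
                + weight σ * 𝟙 (holds (suc n) (select [] 1 σ))) (perms (suc n))
        ≈⟨ trans (∑ₗ-+ _ _ (perms (suc n))) (+-cong (∑ₗ-+ _ _ (perms (suc n))) refl) ⟩
      ∑ₗ (λ σ → (pow 2 * P n) * (weight σ * 𝟙 (winnable2 (suc n) k₁ k₂ σ))) (perms (suc n))
        + ∑ₗ (λ σ → θ * (weight σ * 𝟙 (unpickable σ))) (perms (suc n)) + picksMax n
        ≈⟨ +-cong (+-cong (trans (∑ₗ-*ˡ _ _ (perms (suc n))) (*-cong refl (sym (W₁≈∑ₗ (suc n)))))
                          (trans (∑ₗ-*ˡ _ _ (perms (suc n))) (*-cong refl (sym (T₁'≈∑ₗ (suc n)))))) refl ⟩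
      pow 2 * P n * W₁ (suc n) k₁ k₂ + θ * T₁' (suc n) k₁ k₂ + picksMax n ∎

    -- Weight of the permutations of S_{n+1} whose maximum n + 1, at position j + 1, is selected.
    picksMaxAt : ℕ → ℕ → Carrier
    picksMaxAt n j = (pow (n ∸ j) * 𝟙 (k₁ <ᵇ suc j)) * (T₁' j k₁ k₂ * (B j (n ∸ j) * Pfact (n ∸ j)))

    picksMax≈∑< : ∀ n → picksMax n ≈ ∑< (suc n) (picksMaxAt n)
    picksMax≈∑< n = begin
      picksMax n
        ≈⟨ ∑-perms-insertMax n _ ⟩
      ∑ₗ (λ τ → ∑< (suc n) (λ j → pow (n ∸ j) * (weight τ * 𝟙 (holds (suc n) (select [] 1 (insertAt j (suc n) τ)))))) (perms n)
        ≈⟨ ∑ₗ-congAll (perms n) (perms-IsPerm n) (λ τ (len , bounded , _) → ∑<-cong (suc n) (λ j j< →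
             trans (*-cong refl (*-cong refl (trans
                     (reflexive (≡.cong 𝟙 (holds-select-insertMax n τ j bounded (≡.subst (j ≤_) (≡.sym len) (ℕ.≤-pred j<)))))
                     (𝟙-∧ (k₁ <ᵇ suc j) (unpickable (take j τ))))))
                   (regroup _ _ _ _))) ⟩
      ∑ₗ (λ τ → ∑< (suc n) (λ j → (pow (n ∸ j) * 𝟙 (k₁ <ᵇ suc j)) * (weight τ * 𝟙 (unpickable (take j τ))))) (perms n)
        ≈⟨ ∑ₗ-∑< (suc n) _ (perms n) ⟩
      ∑< (suc n) (λ j → ∑ₗ (λ τ → (pow (n ∸ j) * 𝟙 (k₁ <ᵇ suc j)) * (weight τ * 𝟙 (unpickable (take j τ)))) (perms n))
        ≈⟨ ∑<-cong (suc n) (λ j j< → trans (∑ₗ-*ˡ _ _ (perms n)) (*-cong refl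
             (trans (∑-perms-prefix≤ unpickable unpickable-bump j n (ℕ.≤-pred j<)) (*-cong (sym (T₁'≈∑ₗ j)) refl)))) ⟩
      ∑< (suc n) (picksMaxAt n) ∎
      where
      regroup : ∀ a w b d → a * (w * (b * d)) ≈ (a * b) * (w * d)
      regroup a w b d = trans (*-cong refl (*-CS.x∙yz≈y∙xz w b d)) (sym (*-assoc a b (w * d)))
      unpickable-bump : ∀ x xs → unpickable (map (bump x) xs) ≡ unpickable xs
      unpickable-bump x xs = ≡.cong not (pickable2-bump x xs)

    picksMaxAt-early : ∀ n j → j < k₁ → picksMaxAt n j ≈ 0#
    picksMaxAt-early n j j<k₁ =
      trans (*-cong (trans (*-cong refl (reflexive (≡.cong 𝟙 (<ᵇ-false j<k₁)))) (zeroʳ _)) refl) (zeroˡ _)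

    picksMaxAt-late : ∀ n j → k₁ ≤ j →
      picksMaxAt n j ≈ pow (n ∸ j) * T₁' j k₁ k₂ * B j (n ∸ j) * Pfact (n ∸ j)
    picksMaxAt-late n j k₁≤j = begin
      (pow (n ∸ j) * 𝟙 (k₁ <ᵇ suc j)) * (T₁' j k₁ k₂ * (B j (n ∸ j) * Pfact (n ∸ j)))
        ≈⟨ *-cong (trans (*-cong refl (reflexive (≡.cong 𝟙 (<ᵇ-true (s≤s k₁≤j))))) (*-identityʳ _)) refl ⟩
      pow (n ∸ j) * (T₁' j k₁ k₂ * (B j (n ∸ j) * Pfact (n ∸ j)))
        ≈⟨ trans (*-assoc _ _ _) (*-assoc _ _ _) ⟨
      pow (n ∸ j) * T₁' j k₁ k₂ * B j (n ∸ j) * Pfact (n ∸ j) ∎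

    ∑<-picksMaxAt-split : ∀ n → k₁ ≤ k₂ → k₂ ≤ n →
      ∑< (suc n) (picksMaxAt n) ≈
      ∑< (suc k₂ ∸ k₁) (λ t → picksMaxAt n (k₁ +ℕ t)) + ∑< (n ∸ k₂) (λ t → picksMaxAt n (suc (k₂ +ℕ t)))
    ∑<-picksMaxAt-split n k₁≤k₂ k₂≤n = begin
      ∑< (suc n) (picksMaxAt n)
        ≈⟨ reflexive (≡.cong (λ m → ∑< m (picksMaxAt n)) (≡.sym (≡.cong suc (ℕ.m+[n∸m]≡n k₂≤n)))) ⟩
      ∑< (suc k₂ +ℕ (n ∸ k₂)) (picksMaxAt n)
        ≈⟨ ∑<-+ℕ (suc k₂) (n ∸ k₂) _ ⟩
      ∑< (suc k₂) (picksMaxAt n) + ∑< (n ∸ k₂) (λ t → picksMaxAt n (suc (k₂ +ℕ t)))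
        ≈⟨ +-cong (reflexive (≡.cong (λ m → ∑< m (picksMaxAt n)) (≡.sym (ℕ.m+[n∸m]≡n (ℕ.m≤n⇒m≤1+n k₁≤k₂))))) refl ⟩
      ∑< (k₁ +ℕ (suc k₂ ∸ k₁)) (picksMaxAt n) + ∑< (n ∸ k₂) (λ t → picksMaxAt n (suc (k₂ +ℕ t)))
        ≈⟨ +-cong (∑<-+ℕ k₁ (suc k₂ ∸ k₁) _) refl ⟩
      (∑< k₁ (picksMaxAt n) + ∑< (suc k₂ ∸ k₁) (λ t → picksMaxAt n (k₁ +ℕ t)))
        + ∑< (n ∸ k₂) (λ t → picksMaxAt n (suc (k₂ +ℕ t)))
        ≈⟨ +-cong (trans (+-cong (∑<-zero k₁ _ (picksMaxAt-early n)) refl) (+-identityˡ _)) refl ⟩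
      ∑< (suc k₂ ∸ k₁) (λ t → picksMaxAt n (k₁ +ℕ t)) + ∑< (n ∸ k₂) (λ t → picksMaxAt n (suc (k₂ +ℕ t))) ∎

    lowerTerm upperTerm : ℕ → ℕ → Carrier
    lowerTerm N i = pow (N ∸ i ∸ 1) * T₁ (i ∸ 1) k₁ * B (i ∸ 1) (N ∸ i ∸ 1) * Pfact (N ∸ i ∸ 1)
    upperTerm N i = pow (N ∸ i ∸ 1) * T₁' (i ∸ 1) k₁ k₂ * B (i ∸ 1) (N ∸ i ∸ 1) * Pfact (N ∸ i ∸ 1)

    lowerSum : ∀ n → k₁ ≤ k₂ →
      sumFromTo (k₁ +ℕ 1) (k₂ +ℕ 1) (lowerTerm (suc (suc n))) ≈ ∑< (suc k₂ ∸ k₁) (λ t → picksMaxAt n (k₁ +ℕ t))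
    lowerSum n k₁≤k₂ =
      trans (reflexive (≡.cong₂ (λ a b → sumFromTo a b (lowerTerm (suc (suc n)))) (ℕ.+-comm k₁ 1) (ℕ.+-comm k₂ 1)))
      (trans (sumFromTo≈∑< k₁ k₂ _) (∑<-cong (suc k₂ ∸ k₁) λ t t< → begin
        pow (suc n ∸ (k₁ +ℕ t) ∸ 1) * T₁ (k₁ +ℕ t) k₁ * B (k₁ +ℕ t) (suc n ∸ (k₁ +ℕ t) ∸ 1) * Pfact (suc n ∸ (k₁ +ℕ t) ∸ 1)
          ≈⟨ reflexive (≡.cong (λ d → pow d * T₁ (k₁ +ℕ t) k₁ * B (k₁ +ℕ t) d * Pfact d) (suc∸∸1 n (k₁ +ℕ t))) ⟩
        pow (n ∸ (k₁ +ℕ t)) * T₁ (k₁ +ℕ t) k₁ * B (k₁ +ℕ t) (n ∸ (k₁ +ℕ t)) * Pfact (n ∸ (k₁ +ℕ t))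
          ≈⟨ *-cong (*-cong (*-cong refl (T₁≈T₁' (k₁ +ℕ t) (ℕ.≤-pred (beforeK₂ t<)))) refl) refl ⟩
        pow (n ∸ (k₁ +ℕ t)) * T₁' (k₁ +ℕ t) k₁ k₂ * B (k₁ +ℕ t) (n ∸ (k₁ +ℕ t)) * Pfact (n ∸ (k₁ +ℕ t))
          ≈⟨ picksMaxAt-late n (k₁ +ℕ t) (ℕ.m≤m+n k₁ t) ⟨
        picksMaxAt n (k₁ +ℕ t) ∎))
      where
      beforeK₂ : ∀ {t} → t < suc k₂ ∸ k₁ → k₁ +ℕ t < suc k₂
      beforeK₂ {t} t< = ≡.subst (k₁ +ℕ t <_) (ℕ.m+[n∸m]≡n (ℕ.m≤n⇒m≤1+n k₁≤k₂)) (ℕ.+-monoʳ-< k₁ t<)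

    upperSum : ∀ n → k₁ ≤ k₂ →
      sumFromTo (k₂ +ℕ 2) (suc n) (upperTerm (suc (suc n))) ≈ ∑< (n ∸ k₂) (λ t → picksMaxAt n (suc (k₂ +ℕ t)))
    upperSum n k₁≤k₂ = trans (reflexive (≡.cong (λ a → sumFromTo a (suc n) (upperTerm (suc (suc n)))) (ℕ.+-comm k₂ 2)))
      (trans (sumFromTo≈∑< (suc k₂) n _) (∑<-cong (n ∸ k₂) λ t _ → begin
        pow (suc n ∸ j t ∸ 1) * T₁' (j t) k₁ k₂ * B (j t) (suc n ∸ j t ∸ 1) * Pfact (suc n ∸ j t ∸ 1)
          ≈⟨ reflexive (≡.cong (λ d → pow d * T₁' (j t) k₁ k₂ * B (j t) d * Pfact d) (suc∸∸1 n (j t))) ⟩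
        pow (n ∸ j t) * T₁' (j t) k₁ k₂ * B (j t) (n ∸ j t) * Pfact (n ∸ j t)
          ≈⟨ picksMaxAt-late n (j t) (ℕ.≤-trans k₁≤k₂ (ℕ.m≤n⇒m≤1+n (ℕ.m≤m+n k₂ t))) ⟨
        picksMaxAt n (j t) ∎))
      where
      j : ℕ → ℕ
      j t = suc (k₂ +ℕ t)

theorem13 : {c ℓ : Level} (R : CommutativeSemiring c ℓ)
    (θ : CommutativeSemiring.Carrier R) (N k₁ k₂ : ℕ) →
    k₁ ≤ k₂ → k₂ +ℕ 2 ≤ N →
    let open CommutativeSemiring R
        open GF R θ
    in W₁ N k₁ k₂
       ≈ (pow 2 * P (N ∸ 2) * W₁ (N ∸ 1) k₁ k₂
          + θ * T₁' (N ∸ 1) k₁ k₂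
          + sumFromTo (k₁ +ℕ 1) (k₂ +ℕ 1)
              (λ i → pow (N ∸ i ∸ 1) * T₁ (i ∸ 1) k₁ * B (i ∸ 1) (N ∸ i ∸ 1) * Pfact (N ∸ i ∸ 1))
          + sumFromTo (k₂ +ℕ 2) (N ∸ 1)
              (λ i → pow (N ∸ i ∸ 1) * T₁' (i ∸ 1) k₁ k₂ * B (i ∸ 1) (N ∸ i ∸ 1) * Pfact (N ∸ i ∸ 1)))
theorem13 R θ N k₁ k₂ k₁≤k₂ k₂+2≤N with ≡.subst (_≤ N) (ℕ.+-comm k₂ 2) k₂+2≤N
... | s≤s (s≤s {n = n} k₂≤n) = begin
  W₁ (suc (suc n)) k₁ k₂
    ≈⟨ W₁-decomposition n k₂≤n ⟩
  pow 2 * P n * W₁ (suc n) k₁ k₂ + θ * T₁' (suc n) k₁ k₂ + picksMax n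
    ≈⟨ +-cong refl (trans (picksMax≈∑< n) (∑<-picksMaxAt-split n k₁≤k₂ k₂≤n)) ⟩
  pow 2 * P n * W₁ (suc n) k₁ k₂ + θ * T₁' (suc n) k₁ k₂
    + (∑< (suc k₂ ∸ k₁) (λ t → picksMaxAt n (k₁ +ℕ t)) + ∑< (n ∸ k₂) (λ t → picksMaxAt n (suc (k₂ +ℕ t))))
    ≈⟨ +-cong refl (+-cong (lowerSum n k₁≤k₂) (upperSum n k₁≤k₂)) ⟨
  pow 2 * P n * W₁ (suc n) k₁ k₂ + θ * T₁' (suc n) k₁ k₂
    + (sumFromTo (k₁ +ℕ 1) (k₂ +ℕ 1) (lowerTerm (suc (suc n))) + sumFromTo (k₂ +ℕ 2) (suc n) (upperTerm (suc (suc n))))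
    ≈⟨ +-assoc _ _ _ ⟨
  pow 2 * P n * W₁ (suc n) k₁ k₂ + θ * T₁' (suc n) k₁ k₂
    + sumFromTo (k₁ +ℕ 1) (k₂ +ℕ 1) (lowerTerm (suc (suc n))) + sumFromTo (k₂ +ℕ 2) (suc n) (upperTerm (suc (suc n))) ∎
  where
  open CommutativeSemiring R hiding (zero)
  open GF R θ
  open Sums R
  open Weighted R θ
  open Recurrence k₁ k₂
  open import Relation.Binary.Reasoning.Setoid setoid
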